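{- Let $p$ be a prime and $n\ge k\ge 1$ integers such that $s(n,k)$ is a minimum zero case. Let $t$ be a nonnegative integer with $p^{\nu_p(t)}>n$ (where $\nu_p(0)=+\infty$), and put $n'=t+n$, $k'=t+k$. Then $s(n',k')$ is a minimum zero case and (i) $\nu_p(s(n',k'))=\nu_p(s(n,k))$; (ii) $\epsilon_p(s(n',k'))\equiv\epsilon_p(s(n,k)) \pmod p$.
   Context: $s(n,k)$ is the signed Stirling number of the first kind, defined by $x(x-1)\cdots(x-n+1)=\sum_k s(n,k)x^k$. $\nu_p$ is the $p$-adic valuation, $\sigma_p(m)$ the base-$p$ digit sum, and $\epsilon_p(x)=p^{ -\nu_p(x)}x$ the unit part of a nonzero rational $x$. $s(n,k)$ is called a minimum zero case if $\nu_p(s(n,k))=(\sigma_p(k-1)-\sigma_p(n-1))/(p-1)$. -}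

module Defs where

open import Data.Nat using (ℕ; zero; suc; _+_; _*_; _∸_; _^_; _/_; _%_)
open import Data.Nat.Divisibility using (_∣?_)
open import Data.Integer as ℤ using (ℤ; +_; -[1+_]; ∣_∣; sign; _◃_)
open import Data.Bool using (if_then_else_)
open import Relation.Nullary.Decidable using (does)
open import Relation.Binary.PropositionalEquality using (_≡_; refl)

-- Signed Stirling numbers of the first kind:
--   x(x-1)...(x-n+1) = Σ_k s(n,k) x^k, via the standard recurrence
--   s(n+1,k+1) = s(n,k) - n s(n,k+1).
stirling1 : ℕ → ℕ → ℤ
stirling1 zero    zero    = + 1
stirling1 zero    (suc k) = + 0
stirling1 (suc n) zero    = + 0
stirling1 (suc n) (suc k) = stirling1 n k ℤ.- (+ n) ℤ.* stirling1 n (suc k)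

-- Division by p and remainder mod p (junk value 0 for p = 0; only used for primes).
divP : ℕ → ℕ → ℕ
divP zero    m = 0
divP (suc q) m = m / suc q

modP : ℕ → ℕ → ℕ
modP zero    m = m
modP (suc q) m = m % suc q

-- p-adic valuation of a natural number x ≠ 0 (for p ≥ 2):
-- the largest v ≤ x with p^v ∣ x (such v always satisfy v < x).
-- Junk value 0 for x = 0.
νAux : ℕ → ℕ → ℕ → ℕ
νAux p x zero    = 0
νAux p x (suc v) = if does ((p ^ suc v) ∣? x) then suc v else νAux p x v

ν : ℕ → ℕ → ℕ
ν p x = νAux p x x

νℤ : ℕ → ℤ → ℕ
νℤ p z = ν p ∣ z ∣

-- base-p digit sum σ_p(m) (fuel m suffices since m / p < m for m ≥ 1, p ≥ 2).
σAux : ℕ → ℕ → ℕ → ℕ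
σAux p zero     m = 0
σAux p (suc f)  m = modP p m + σAux p f (divP p m)

σ : ℕ → ℕ → ℕ
σ p m = σAux p m m

ε : ℕ → ℤ → ℤ
ε p z = sign z ◃ divP (p ^ νℤ p z) ∣ z ∣

-- s(n,k) is a minimum zero case:
--   ν_p(s(n,k)) = (σ_p(k-1) - σ_p(n-1)) / (p-1),
-- written multiplied out as (p-1) ν_p(s(n,k)) + σ_p(n-1) = σ_p(k-1).
MinZeroCase : ℕ → ℕ → ℕ → Set
MinZeroCase p n k = (p ∸ 1) * νℤ p (stirling1 n k) + σ p (n ∸ 1) ≡ σ p (k ∸ 1)

-- Write q = p − 1 and (x)ₘ for the falling factorial. Every Stirling number satisfies the
-- minimum bound q·νₚ(s(n+1, k+1)) + σₚ(n) ≥ σₚ(k). It follows by induction from expansions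
-- of s(n+1, k+1) and of (k+1)·s(m, k+1) (a coefficient of the derivative of (x)ₘ) in terms
-- of smaller Stirling numbers, whose coefficients are quotients of falling factorials with
-- valuations given by Legendre's formula.
--
-- Now let t be a positive multiple of pᵃ > n. Since (x)ₜ₊ₙ = (x)ₜ₊₁ · g(x − t) with
-- g(x) = (x − 1)⋯(x − n + 1), the number s(t+n, t+k) is a convolution of the coefficients
-- of (x)ₜ₊₁ and of g(x − t). The term using s(t+1, t+1) = 1 is the coefficient of x^(k−1)
-- in g(x − t), which differs from the coefficient s(n, k) of g by multiples of high powers
-- of t; every other term needs a base-p carry. So s(t+n, t+k) − s(n, k) beats the minimum
-- bound by q, and in a minimum zero case its valuation exceeds νₚ(s(n, k)): the valuations
-- agree and the unit parts are congruent mod p. Finally σₚ(t + m) = σₚ(t) + σₚ(m) for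
-- m < pᵃ, so the shifted pair is again a minimum zero case.

{-# OPTIONS --safe #-}
module Submission where

open import Defs
open import Data.Nat using (ℕ; _+_; _^_; _≤_; _<_)
open import Data.Nat.Primality using (Prime)
open import Data.Integer using (+_; _-_)
open import Data.Integer.Divisibility using (_∣_)
open import Data.Product using (_×_)
open import Data.Sum using (_⊎_)
open import Relation.Binary.PropositionalEquality using (_≡_)

open import Data.Nat using (zero; suc; _*_; _∸_; z≤n; s≤s; _/_; _%_)
import Data.Nat as ℕ using (≢-nonZero; ≢-nonZero⁻¹)
import Data.Nat.Properties as ℕ
import Data.Nat.Divisibility as ℕ
import Data.Nat.DivMod as ℕ
import Data.Nat.Tactic.RingSolver as ℕ
open import Data.Nat.Divisibility using (divides; _∣?_)
open import Data.Nat.Primality using (euclidsLemma)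
open import Data.Integer using (ℤ; -_; ∣_∣; sign; _◃_) renaming (_+_ to _+ᶻ_; _*_ to _*ᶻ_)
import Data.Integer.Properties as ℤ
import Data.Integer.Divisibility.Signed as Signed
open import Data.Integer.Tactic.RingSolver using (solve-∀)
import Data.Sign as Sign
import Data.Sign.Properties as Sign
open import Data.Product using (_,_; proj₁; proj₂; Σ-syntax)
open import Data.Sum using (inj₁; inj₂; [_,_]′)
open import Data.Empty using (⊥-elim)
open import Relation.Nullary using (¬_; Dec; yes; no)
open import Relation.Binary.Definitions using (tri<; tri≈; tri>)
open import Relation.Binary.PropositionalEquality
  using (_≢_; refl; sym; trans; cong; cong₂; subst; subst₂; module ≡-Reasoning)

∑ : ℕ → (ℕ → ℤ) → ℤ
∑ zero    f = + 0
∑ (suc n) f = f 0 +ᶻ ∑ n (λ i → f (suc i))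

∑-cong< : ∀ n {f g : ℕ → ℤ} → (∀ i → i < n → f i ≡ g i) → ∑ n f ≡ ∑ n g
∑-cong< zero    eq = refl
∑-cong< (suc n) eq = cong₂ _+ᶻ_ (eq 0 (s≤s z≤n)) (∑-cong< n (λ i i<n → eq (suc i) (s≤s i<n)))

∑-cong : ∀ n {f g : ℕ → ℤ} → (∀ i → f i ≡ g i) → ∑ n f ≡ ∑ n g
∑-cong n eq = ∑-cong< n (λ i _ → eq i)

∑-zero : ∀ n {f : ℕ → ℤ} → (∀ i → i < n → f i ≡ + 0) → ∑ n f ≡ + 0
∑-zero n eq = trans (∑-cong< n eq) (∑-const n)
  where
  ∑-const : ∀ n → ∑ n (λ _ → + 0) ≡ + 0
  ∑-const zero    = refl
  ∑-const (suc n) = trans (ℤ.+-identityˡ _) (∑-const n)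

∑-+ : ∀ n (f g : ℕ → ℤ) → ∑ n (λ i → f i +ᶻ g i) ≡ ∑ n f +ᶻ ∑ n g
∑-+ zero    f g = refl
∑-+ (suc n) f g = trans (cong (f 0 +ᶻ g 0 +ᶻ_) (∑-+ n _ _)) (medial (f 0) (g 0) _ _)
  where
  medial : ∀ a b c d → (a +ᶻ b) +ᶻ (c +ᶻ d) ≡ (a +ᶻ c) +ᶻ (b +ᶻ d)
  medial = solve-∀

∑-sub-* : ∀ n c (f g : ℕ → ℤ) → ∑ n (λ i → f i - c *ᶻ g i) ≡ ∑ n f - c *ᶻ ∑ n g
∑-sub-* zero    c f g = sym (annihilate c)
  where
  annihilate : ∀ c → + 0 - c *ᶻ + 0 ≡ + 0
  annihilate = solve-∀
∑-sub-* (suc n) c f g =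
  trans (cong (f 0 - c *ᶻ g 0 +ᶻ_) (∑-sub-* n c _ _)) (regroup (f 0) (g 0) _ _ c)
  where
  regroup : ∀ a b A B c → (a - c *ᶻ b) +ᶻ (A - c *ᶻ B) ≡ (a +ᶻ A) - c *ᶻ (b +ᶻ B)
  regroup = solve-∀

∑-*ˡ : ∀ n c (f : ℕ → ℤ) → ∑ n (λ i → c *ᶻ f i) ≡ c *ᶻ ∑ n f
∑-*ˡ zero    c f = sym (ℤ.*-zeroʳ c)
∑-*ˡ (suc n) c f = trans (cong (c *ᶻ f 0 +ᶻ_) (∑-*ˡ n c _)) (sym (ℤ.*-distribˡ-+ c (f 0) _))

∑-init-last : ∀ n (f : ℕ → ℤ) → ∑ (suc n) f ≡ ∑ n f +ᶻ f n
∑-init-last zero    f = ℤ.+-comm (f 0) (+ 0)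
∑-init-last (suc n) f = trans (cong (f 0 +ᶻ_) (∑-init-last n _)) (sym (ℤ.+-assoc (f 0) _ _))

neg^ : ℕ → ℤ → ℤ
neg^ zero    z = z
neg^ (suc r) z = - neg^ r z

neg^-+ : ∀ r a b → neg^ r (a +ᶻ b) ≡ neg^ r a +ᶻ neg^ r b
neg^-+ zero    a b = refl
neg^-+ (suc r) a b = trans (cong -_ (neg^-+ r a b)) (ℤ.neg-distrib-+ (neg^ r a) _)

neg^-*ˡ : ∀ r a b → neg^ r (a *ᶻ b) ≡ a *ᶻ neg^ r b
neg^-*ˡ zero    a b = refl
neg^-*ˡ (suc r) a b = trans (cong -_ (neg^-*ˡ r a b)) (ℤ.neg-distribʳ-* a (neg^ r b))

neg^-zero : ∀ r → neg^ r (+ 0) ≡ + 0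
neg^-zero zero    = refl
neg^-zero (suc r) = cong -_ (neg^-zero r)

∣neg^∣ : ∀ r z → ∣ neg^ r z ∣ ≡ ∣ z ∣
∣neg^∣ zero    z = refl
∣neg^∣ (suc r) z = trans (ℤ.∣-i∣≡∣i∣ (neg^ r z)) (∣neg^∣ r z)

-- Polynomials as coefficient sequences

-- mulX f and xMinus c f are the coefficient sequences of x · f and (x − c) · f.
mulX : (ℕ → ℤ) → ℕ → ℤ
mulX f zero    = + 0
mulX f (suc l) = f l

xMinus : ℕ → (ℕ → ℤ) → ℕ → ℤ
xMinus c f l = mulX f l - + c *ᶻ f l

one : ℕ → ℤ
one zero    = + 1
one (suc l) = + 0

mulX-cong : ∀ {f g : ℕ → ℤ} → (∀ l → f l ≡ g l) → ∀ l → mulX f l ≡ mulX g l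
mulX-cong eq zero    = refl
mulX-cong eq (suc l) = eq l

xMinus-cong : ∀ c {f g : ℕ → ℤ} → (∀ l → f l ≡ g l) → ∀ l → xMinus c f l ≡ xMinus c g l
xMinus-cong c eq l = cong₂ (λ a b → a - + c *ᶻ b) (mulX-cong eq l) (eq l)

xMinus-+ : ∀ a b f l → xMinus (a + b) f l ≡ xMinus a f l - + b *ᶻ f l
xMinus-+ a b f l = trans (cong (λ c → mulX f l - c *ᶻ f l) (ℤ.pos-+ a b)) (split (mulX f l) (+ a) (+ b) (f l))
  where
  split : ∀ m a b x → m - (a +ᶻ b) *ᶻ x ≡ (m - a *ᶻ x) - b *ᶻ x
  split = solve-∀

xMinus-∑ : ∀ c n (a : ℕ → ℤ) (F : ℕ → ℕ → ℤ) l →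
  xMinus c (λ l → ∑ n (λ i → a i *ᶻ F i l)) l ≡ ∑ n (λ i → a i *ᶻ xMinus c (F i) l)
xMinus-∑ c n a F l = begin
    mulX (λ l → ∑ n (λ i → a i *ᶻ F i l)) l - + c *ᶻ ∑ n (λ i → a i *ᶻ F i l)
  ≡⟨ cong (λ z → z - + c *ᶻ ∑ n (λ i → a i *ᶻ F i l)) (mulX-∑ l) ⟩
    ∑ n (λ i → a i *ᶻ mulX (F i) l) - + c *ᶻ ∑ n (λ i → a i *ᶻ F i l)
  ≡⟨ ∑-sub-* n (+ c) _ _ ⟨
    ∑ n (λ i → a i *ᶻ mulX (F i) l - + c *ᶻ (a i *ᶻ F i l))
  ≡⟨ ∑-cong n (λ i → factor (a i) (mulX (F i) l) (+ c) (F i l)) ⟩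
    ∑ n (λ i → a i *ᶻ xMinus c (F i) l)
  ∎
  where
  open ≡-Reasoning
  mulX-∑ : ∀ l → mulX (λ l → ∑ n (λ i → a i *ᶻ F i l)) l ≡ ∑ n (λ i → a i *ᶻ mulX (F i) l)
  mulX-∑ zero    = sym (∑-zero n (λ i _ → ℤ.*-zeroʳ (a i)))
  mulX-∑ (suc l) = refl
  factor : ∀ a x c y → a *ᶻ x - c *ᶻ (a *ᶻ y) ≡ a *ᶻ (x - c *ᶻ y)
  factor = solve-∀

Monic : ℕ → (ℕ → ℤ) → Set
Monic d f = (∀ l → d < l → f l ≡ + 0) × f d ≡ + 1

Monic-cong : ∀ {d} {f g : ℕ → ℤ} → (∀ l → f l ≡ g l) → Monic d f → Monic d g
Monic-cong eq (above , lead) = (λ l d<l → trans (sym (eq l)) (above l d<l)) , trans (sym (eq _)) lead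

one-monic : Monic 0 one
one-monic = (λ { (suc l) _ → refl }) , refl

xMinus-monic : ∀ c {d f} → Monic d f → Monic (suc d) (xMinus c f)
xMinus-monic c {d} {f} (above , lead) = above′ , lead′
  where
  drop : ∀ a c → a - c *ᶻ + 0 ≡ a
  drop = solve-∀
  above′ : ∀ l → suc d < l → xMinus c f l ≡ + 0
  above′ (suc l) (s≤s d<l) =
    trans (cong₂ (λ a b → a - + c *ᶻ b) (above l d<l) (above (suc l) (ℕ.m<n⇒m<1+n d<l))) (drop (+ 0) (+ c))
  lead′ : xMinus c f (suc d) ≡ + 1
  lead′ = trans (cong₂ (λ a b → a - + c *ᶻ b) lead (above (suc d) (ℕ.n<1+n d))) (drop (+ 1) (+ c))

deriv : (ℕ → ℤ) → ℕ → ℤ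
deriv f l = + suc l *ᶻ f (suc l)

deriv-xMinus : ∀ c f l → deriv (xMinus c f) l ≡ f l +ᶻ xMinus c (deriv f) l
deriv-xMinus c f zero    = leibniz (f 0) (f 1) (+ c)
  where
  leibniz : ∀ a b c → + 1 *ᶻ (a - c *ᶻ b) ≡ a +ᶻ (+ 0 - c *ᶻ (+ 1 *ᶻ b))
  leibniz = solve-∀
deriv-xMinus c f (suc l) = leibniz (f (suc l)) (f (suc (suc l))) (+ c) (+ suc l)
  where
  leibniz : ∀ a b c L → (+ 1 +ᶻ L) *ᶻ (a - c *ᶻ b) ≡ a +ᶻ (L *ᶻ a - c *ᶻ ((+ 1 +ᶻ L) *ᶻ b))
  leibniz = solve-∀

conv : (ℕ → ℤ) → (ℕ → ℤ) → ℕ → ℤ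
conv f g K = ∑ (suc K) (λ i → f i *ᶻ g (K ∸ i))

conv-oneʳ : ∀ f K → conv f one K ≡ f K
conv-oneʳ f zero    = trans (ℤ.+-identityʳ _) (ℤ.*-identityʳ (f 0))
conv-oneʳ f (suc K) = trans (cong (_+ᶻ conv (λ i → f (suc i)) one K) (ℤ.*-zeroʳ (f 0)))
                           (trans (ℤ.+-identityˡ _) (conv-oneʳ (λ i → f (suc i)) K))

conv-mulX : ∀ f g K → conv f (mulX g) K ≡ mulX (conv f g) K
conv-mulX f g zero    = trans (ℤ.+-identityʳ _) (ℤ.*-zeroʳ (f 0))
conv-mulX f g (suc K) = shift f K
  where
  shift : ∀ f K → conv f (mulX g) (suc K) ≡ conv f g K
  shift f zero    = cong (λ z → f 0 *ᶻ g 0 +ᶻ (z +ᶻ + 0)) (ℤ.*-zeroʳ (f 1))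
  shift f (suc K) = cong (f 0 *ᶻ g (suc K) +ᶻ_) (shift (λ i → f (suc i)) K)

conv-xMinus : ∀ c f g K → conv f (xMinus c g) K ≡ xMinus c (conv f g) K
conv-xMinus c f g K = begin
    ∑ (suc K) (λ i → f i *ᶻ (mulX g (K ∸ i) - + c *ᶻ g (K ∸ i)))
  ≡⟨ ∑-cong (suc K) (λ i → distrib (f i) (mulX g (K ∸ i)) (+ c) (g (K ∸ i))) ⟩
    ∑ (suc K) (λ i → f i *ᶻ mulX g (K ∸ i) - + c *ᶻ (f i *ᶻ g (K ∸ i)))
  ≡⟨ ∑-sub-* (suc K) (+ c) (λ i → f i *ᶻ mulX g (K ∸ i)) (λ i → f i *ᶻ g (K ∸ i)) ⟩
    conv f (mulX g) K - + c *ᶻ conv f g K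
  ≡⟨ cong (_- + c *ᶻ conv f g K) (conv-mulX f g K) ⟩
    xMinus c (conv f g) K
  ∎
  where
  open ≡-Reasoning
  distrib : ∀ a x c y → a *ᶻ (x - c *ᶻ y) ≡ a *ᶻ x - c *ᶻ (a *ᶻ y)
  distrib = solve-∀

xMinusPow : ℕ → ℕ → ℕ → ℤ
xMinusPow t zero    = one
xMinusPow t (suc i) = xMinus t (xMinusPow t i)

xMinusPow-monic : ∀ t i → Monic i (xMinusPow t i)
xMinusPow-monic t zero    = one-monic
xMinusPow-monic t (suc i) = xMinus-monic t (xMinusPow-monic t i)

-- Coefficients of g (x − t), for g of degree below B.
translate : ℕ → ℕ → (ℕ → ℤ) → ℕ → ℤ
translate t B g l = ∑ B (λ i → g i *ᶻ xMinusPow t i l)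

translate-xMinus : ∀ t c B g → g B ≡ + 0 → ∀ l →
  translate t (suc B) (xMinus c g) l ≡ xMinus (t + c) (translate t B g) l
translate-xMinus t c B g gB≡0 l = begin
    ∑ (suc B) (λ i → xMinus c g i *ᶻ W i)
  ≡⟨ ∑-cong (suc B) (λ i → distrib (mulX g i) (+ c) (g i) (W i)) ⟩
    ∑ (suc B) (λ i → mulX g i *ᶻ W i - + c *ᶻ (g i *ᶻ W i))
  ≡⟨ ∑-sub-* (suc B) (+ c) (λ i → mulX g i *ᶻ W i) (λ i → g i *ᶻ W i) ⟩
    ∑ (suc B) (λ i → mulX g i *ᶻ W i) - + c *ᶻ translate t (suc B) g l
  ≡⟨ cong₂ (λ x y → x - + c *ᶻ y) lowered top-vanishes ⟩
    xMinus t (translate t B g) l - + c *ᶻ translate t B g l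
  ≡⟨ xMinus-+ t c (translate t B g) l ⟨
    xMinus (t + c) (translate t B g) l
  ∎
  where
  open ≡-Reasoning
  W : ℕ → ℤ
  W i = xMinusPow t i l
  distrib : ∀ m c x w → (m - c *ᶻ x) *ᶻ w ≡ m *ᶻ w - c *ᶻ (x *ᶻ w)
  distrib = solve-∀
  lowered : ∑ (suc B) (λ i → mulX g i *ᶻ W i) ≡ xMinus t (translate t B g) l
  lowered = trans (ℤ.+-identityˡ _) (sym (xMinus-∑ t B g (xMinusPow t) l))
  top-vanishes : translate t (suc B) g l ≡ translate t B g l
  top-vanishes = trans (∑-init-last B (λ i → g i *ᶻ W i))
                       (trans (cong (λ z → translate t B g l +ᶻ z *ᶻ W B) gB≡0) (ℤ.+-identityʳ _))

^-monoʳ-∣ : ∀ m {a b} → a ≤ b → m ^ a ℕ.∣ m ^ b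
^-monoʳ-∣ m {a} {b} a≤b = subst (m ^ a ℕ.∣_)
  (trans (sym (ℕ.^-distribˡ-+-* m a (b ∸ a))) (cong (m ^_) (ℕ.m+[n∸m]≡n a≤b))) (ℕ.m∣m*n (m ^ (b ∸ a)))

∣-+ : ∀ {d} a b → + d ∣ a → + d ∣ b → + d ∣ a +ᶻ b
∣-+ {d} a b d∣a d∣b =
  Signed.∣⇒∣ᵤ {+ d} {a +ᶻ b} (Signed.∣m∣n⇒∣m+n (Signed.∣ᵤ⇒∣ {+ d} {a} d∣a) (Signed.∣ᵤ⇒∣ {+ d} {b} d∣b))

∣-neg : ∀ {d} a → + d ∣ a → + d ∣ - a
∣-neg {d} a = subst (d ℕ.∣_) (sym (ℤ.∣-i∣≡∣i∣ a))

∣-* : ∀ {d e} a b → + d ∣ a → + e ∣ b → + (d * e) ∣ a *ᶻ b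
∣-* {d} {e} a b d∣a e∣b = subst (d * e ℕ.∣_) (sym (ℤ.abs-* a b)) (ℕ.*-pres-∣ d∣a e∣b)

m∸n≤1+[m∸1+n] : ∀ m n → m ∸ n ≤ suc (m ∸ suc n)
m∸n≤1+[m∸1+n] zero    n       = subst (_≤ suc (0 ∸ suc n)) (sym (ℕ.0∸n≡0 n)) z≤n
m∸n≤1+[m∸1+n] (suc m) zero    = ℕ.≤-refl
m∸n≤1+[m∸1+n] (suc m) (suc n) = m∸n≤1+[m∸1+n] m n

xMinusPow-divisible : ∀ {d t} → d ℕ.∣ t → ∀ i l → + (d ^ (i ∸ l)) ∣ xMinusPow t i l
xMinusPow-divisible {d} d∣t zero    l = subst (λ e → d ^ e ℕ.∣ ∣ one l ∣) (sym (ℕ.0∸n≡0 l)) (ℕ.1∣ _)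
xMinusPow-divisible {d} {t} d∣t (suc i) zero =
  subst (+ (d * d ^ i) ∣_) (sym (ℤ.+-identityˡ (- (+ t *ᶻ xMinusPow t i 0))))
    (∣-neg (+ t *ᶻ xMinusPow t i 0) (∣-* (+ t) (xMinusPow t i 0) d∣t (xMinusPow-divisible d∣t i 0)))
xMinusPow-divisible {d} {t} d∣t (suc i) (suc l) =
  ∣-+ (xMinusPow t i l) (- (+ t *ᶻ xMinusPow t i (suc l))) (xMinusPow-divisible d∣t i l)
    (∣-neg (+ t *ᶻ xMinusPow t i (suc l))
      (ℕ.∣-trans (^-monoʳ-∣ d (m∸n≤1+[m∸1+n] i l))
        (∣-* (+ t) (xMinusPow t i (suc l)) d∣t (xMinusPow-divisible d∣t i (suc l)))))

-- Stirling numbers of the first kind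

s : ℕ → ℕ → ℤ
s = stirling1

stirling1-suc : ∀ n K → s (suc n) K ≡ xMinus n (s n) K
stirling1-suc zero    zero    = refl
stirling1-suc (suc n) zero    = sym (cong (λ z → + 0 - z) (ℤ.*-zeroʳ (+ suc n)))
stirling1-suc n       (suc K) = refl

stirling1-monic : ∀ n → Monic n (s n)
stirling1-monic zero    = (λ { (suc l) _ → refl }) , refl
stirling1-monic (suc n) = Monic-cong (λ K → sym (stirling1-suc n K)) (xMinus-monic n (stirling1-monic n))

stirling1ᵘ : ℕ → ℕ → ℕ
stirling1ᵘ zero    zero    = 1
stirling1ᵘ zero    (suc k) = 0
stirling1ᵘ (suc n) zero    = 0
stirling1ᵘ (suc n) (suc k) = stirling1ᵘ n k + n * stirling1ᵘ n (suc k)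

stirling1-sign : ∀ n k → s n k ≡ neg^ (n + k) (+ stirling1ᵘ n k)
stirling1-sign zero    zero    = refl
stirling1-sign zero    (suc k) = sym (neg^-zero (suc k))
stirling1-sign (suc n) zero    = sym (neg^-zero (suc (n + 0)))
stirling1-sign (suc n) (suc k) = begin
    s n k - + n *ᶻ s n (suc k)
  ≡⟨ cong₂ (λ a b → a - + n *ᶻ b) (stirling1-sign n k) (stirling1-sign n (suc k)) ⟩
    neg^ (n + k) (+ c) - + n *ᶻ neg^ (n + suc k) (+ c′)
  ≡⟨ cong (λ r → neg^ (n + k) (+ c) - + n *ᶻ neg^ r (+ c′)) (ℕ.+-suc n k) ⟩
    neg^ (n + k) (+ c) - + n *ᶻ - neg^ (n + k) (+ c′)
  ≡⟨ minus-neg (neg^ (n + k) (+ c)) (+ n) (neg^ (n + k) (+ c′)) ⟩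
    neg^ (n + k) (+ c) +ᶻ + n *ᶻ neg^ (n + k) (+ c′)
  ≡⟨ cong (neg^ (n + k) (+ c) +ᶻ_) (neg^-*ˡ (n + k) (+ n) (+ c′)) ⟨
    neg^ (n + k) (+ c) +ᶻ neg^ (n + k) (+ n *ᶻ + c′)
  ≡⟨ neg^-+ (n + k) (+ c) (+ n *ᶻ + c′) ⟨
    neg^ (n + k) (+ c +ᶻ + n *ᶻ + c′)
  ≡⟨ cong (neg^ (n + k)) (trans (ℤ.pos-+ c (n * c′)) (cong (+ c +ᶻ_) (ℤ.pos-* n c′))) ⟨
    neg^ (n + k) (+ stirling1ᵘ (suc n) (suc k))
  ≡⟨ ℤ.neg-involutive _ ⟨
    - - neg^ (n + k) (+ stirling1ᵘ (suc n) (suc k))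
  ≡⟨ cong (λ r → neg^ (suc r) (+ stirling1ᵘ (suc n) (suc k))) (ℕ.+-suc n k) ⟨
    neg^ (suc n + suc k) (+ stirling1ᵘ (suc n) (suc k))
  ∎
  where
  open ≡-Reasoning
  c c′ : ℕ
  c  = stirling1ᵘ n k
  c′ = stirling1ᵘ n (suc k)
  minus-neg : ∀ a n b → a - n *ᶻ (- b) ≡ a +ᶻ n *ᶻ b
  minus-neg = solve-∀

stirling1ᵘ-pos : ∀ N M → M ≤ N → 0 < stirling1ᵘ (suc N) (suc M)
stirling1ᵘ-pos zero    zero    _         = s≤s z≤n
stirling1ᵘ-pos (suc N) zero    _ with stirling1ᵘ (suc N) 1 | stirling1ᵘ-pos N zero z≤n
... | suc _ | _ = s≤s z≤n
stirling1ᵘ-pos (suc N) (suc M) (s≤s M≤N) = ℕ.<-≤-trans (stirling1ᵘ-pos N M M≤N) (ℕ.m≤m+n _ _)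

stirling1-nonzero : ∀ N M → M ≤ N → s (suc N) (suc M) ≢ + 0
stirling1-nonzero N M M≤N s≡0 = ℕ.n>0⇒n≢0 (stirling1ᵘ-pos N M M≤N) (begin
    stirling1ᵘ (suc N) (suc M)
  ≡⟨ ∣neg^∣ (suc N + suc M) _ ⟨
    ∣ neg^ (suc N + suc M) (+ stirling1ᵘ (suc N) (suc M)) ∣
  ≡⟨ cong ∣_∣ (stirling1-sign (suc N) (suc M)) ⟨
    ∣ s (suc N) (suc M) ∣
  ≡⟨ cong ∣_∣ s≡0 ⟩
    0
  ∎)
  where open ≡-Reasoning

falling : ℕ → ℕ → ℕ
falling m       zero    = 1
falling zero    (suc r) = 0
falling (suc m) (suc r) = suc m * falling m r

falling-above : ∀ m r → m < r → falling m r ≡ 0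
falling-above zero    (suc r) _         = refl
falling-above (suc m) (suc r) (s≤s m<r) = trans (cong (suc m *_) (falling-above m r m<r)) (ℕ.*-zeroʳ (suc m))

falling-suc : ∀ m i → falling m (suc i) ≡ falling m i * (m ∸ i)
falling-suc zero    zero    = refl
falling-suc zero    (suc i) = refl
falling-suc (suc m) zero    = trans (ℕ.*-identityʳ (suc m)) (sym (ℕ.+-identityʳ (suc m)))
falling-suc (suc m) (suc i) = trans (cong (suc m *_) (falling-suc m i)) (sym (ℕ.*-assoc (suc m) (falling m i) (m ∸ i)))

-- fallingQuot m i = (m)ᵢ₊₁ / (i + 1)
fallingQuot : ℕ → ℕ → ℕ
fallingQuot zero    i = 0
fallingQuot (suc m) i = fallingQuot m i + falling m i

suc-*-fallingQuot : ∀ m i → suc i * fallingQuot m i ≡ falling m (suc i)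
suc-*-fallingQuot zero    i = ℕ.*-zeroʳ (suc i)
suc-*-fallingQuot (suc m) i = begin
    suc i * (fallingQuot m i + falling m i)
  ≡⟨ ℕ.*-distribˡ-+ (suc i) (fallingQuot m i) (falling m i) ⟩
    suc i * fallingQuot m i + suc i * falling m i
  ≡⟨ cong (_+ suc i * falling m i) (trans (suc-*-fallingQuot m i) (falling-suc m i)) ⟩
    falling m i * (m ∸ i) + suc i * falling m i
  ≡⟨ cong (_+ suc i * falling m i) (ℕ.*-comm (falling m i) (m ∸ i)) ⟩
    (m ∸ i) * falling m i + suc i * falling m i
  ≡⟨ ℕ.*-distribʳ-+ (falling m i) (m ∸ i) (suc i) ⟨
    (m ∸ i + suc i) * falling m i
  ≡⟨ factor (ℕ.≤-<-connex i m) ⟩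
    suc m * falling m i
  ∎
  where
  open ≡-Reasoning
  factor : i ≤ m ⊎ m < i → (m ∸ i + suc i) * falling m i ≡ suc m * falling m i
  factor (inj₁ i≤m) = cong (_* falling m i) (trans (ℕ.+-suc (m ∸ i) i) (cong suc (ℕ.m∸n+n≡m i≤m)))
  factor (inj₂ m<i) rewrite falling-above m i m<i = trans (ℕ.*-zeroʳ (m ∸ i + suc i)) (sym (ℕ.*-zeroʳ (suc m)))

fallingQuot-self : ∀ m → fallingQuot m m ≡ 0
fallingQuot-self m = ℕ.*-cancelˡ-≡ (fallingQuot m m) 0 (suc m)
  (trans (suc-*-fallingQuot m m) (trans (falling-above m (suc m) (ℕ.n<1+n m)) (sym (ℕ.*-zeroʳ (suc m)))))

stirling1-expansion : ∀ n k →
  s (suc n) (suc k) ≡ ∑ (suc n) (λ r → neg^ r (+ falling n r) *ᶻ s (n ∸ r) k)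
stirling1-expansion zero    k = lemma (s 0 k) (s 0 (suc k))
  where
  lemma : ∀ x y → x - + 0 *ᶻ y ≡ + 1 *ᶻ x +ᶻ + 0
  lemma = solve-∀
stirling1-expansion (suc n) k = begin
    s (suc n) k - + suc n *ᶻ s (suc n) (suc k)
  ≡⟨ cong (λ z → s (suc n) k - + suc n *ᶻ z) (stirling1-expansion n k) ⟩
    s (suc n) k - + suc n *ᶻ ∑ (suc n) term
  ≡⟨ cong (s (suc n) k +ᶻ_) (ℤ.neg-distribˡ-* (+ suc n) (∑ (suc n) term)) ⟩
    s (suc n) k +ᶻ - + suc n *ᶻ ∑ (suc n) term
  ≡⟨ cong (s (suc n) k +ᶻ_) (∑-*ˡ (suc n) (- + suc n) term) ⟨
    s (suc n) k +ᶻ ∑ (suc n) (λ r → - + suc n *ᶻ term r)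
  ≡⟨ cong₂ _+ᶻ_ (sym (ℤ.*-identityˡ (s (suc n) k))) (∑-cong (suc n) step) ⟩
    + 1 *ᶻ s (suc n) k +ᶻ ∑ (suc n) (λ r → neg^ (suc r) (+ falling (suc n) (suc r)) *ᶻ s (n ∸ r) k)
  ∎
  where
  open ≡-Reasoning
  term : ℕ → ℤ
  term r = neg^ r (+ falling n r) *ᶻ s (n ∸ r) k
  step : ∀ r → - + suc n *ᶻ term r ≡ neg^ (suc r) (+ falling (suc n) (suc r)) *ᶻ s (n ∸ r) k
  step r = begin
      - + suc n *ᶻ (neg^ r (+ falling n r) *ᶻ s (n ∸ r) k)
    ≡⟨ assoc (+ suc n) (neg^ r (+ falling n r)) (s (n ∸ r) k) ⟩
      - (+ suc n *ᶻ neg^ r (+ falling n r)) *ᶻ s (n ∸ r) k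
    ≡⟨ cong (λ z → - z *ᶻ s (n ∸ r) k) (sym (neg^-*ˡ r (+ suc n) (+ falling n r))) ⟩
      - neg^ r (+ suc n *ᶻ + falling n r) *ᶻ s (n ∸ r) k
    ≡⟨ cong (λ z → - neg^ r z *ᶻ s (n ∸ r) k) (sym (ℤ.pos-* (suc n) (falling n r))) ⟩
      neg^ (suc r) (+ falling (suc n) (suc r)) *ᶻ s (n ∸ r) k
    ∎
    where
    assoc : ∀ a b c → - a *ᶻ (b *ᶻ c) ≡ - (a *ᶻ b) *ᶻ c
    assoc = solve-∀

xMinus-stirling1 : ∀ d e l → xMinus (d + e) (s d) l ≡ s (suc d) l - + e *ᶻ s d l
xMinus-stirling1 d e l = trans (xMinus-+ d e (s d) l) (cong (_- + e *ᶻ s d l) (sym (stirling1-suc d l)))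

neg^-falling-suc : ∀ m i → neg^ (suc i) (+ falling m (suc i)) ≡ - (+ suc i *ᶻ neg^ i (+ fallingQuot m i))
neg^-falling-suc m i = cong -_ (begin
    neg^ i (+ falling m (suc i))
  ≡⟨ cong (λ x → neg^ i (+ x)) (suc-*-fallingQuot m i) ⟨
    neg^ i (+ (suc i * fallingQuot m i))
  ≡⟨ cong (neg^ i) (ℤ.pos-* (suc i) (fallingQuot m i)) ⟩
    neg^ i (+ suc i *ᶻ + fallingQuot m i)
  ≡⟨ neg^-*ˡ i (+ suc i) (+ fallingQuot m i) ⟩
    + suc i *ᶻ neg^ i (+ fallingQuot m i)
  ∎)
  where open ≡-Reasoning

fallingQuot-xMinus : ∀ m j i → i < m →
  neg^ i (+ fallingQuot m i) *ᶻ xMinus m (s (m ∸ suc i)) j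
  ≡ neg^ i (+ fallingQuot m i) *ᶻ s (m ∸ i) j +ᶻ neg^ (suc i) (+ falling m (suc i)) *ᶻ s (m ∸ suc i) j
fallingQuot-xMinus m j i i<m = begin
    a *ᶻ xMinus m (s (m ∸ suc i)) j
  ≡⟨ cong (λ c → a *ᶻ xMinus c (s (m ∸ suc i)) j) (ℕ.m∸n+n≡m i<m) ⟨
    a *ᶻ xMinus (m ∸ suc i + suc i) (s (m ∸ suc i)) j
  ≡⟨ cong (a *ᶻ_) (xMinus-stirling1 (m ∸ suc i) (suc i) j) ⟩
    a *ᶻ (s (suc (m ∸ suc i)) j - + suc i *ᶻ s (m ∸ suc i) j)
  ≡⟨ cong (λ d → a *ᶻ (s d j - + suc i *ᶻ s (m ∸ suc i) j)) (ℕ.+-∸-assoc 1 i<m) ⟨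
    a *ᶻ (s (m ∸ i) j - + suc i *ᶻ s (m ∸ suc i) j)
  ≡⟨ expand a (s (m ∸ i) j) (+ suc i) (s (m ∸ suc i) j) ⟩
    a *ᶻ s (m ∸ i) j +ᶻ - (+ suc i *ᶻ a) *ᶻ s (m ∸ suc i) j
  ≡⟨ cong (λ z → a *ᶻ s (m ∸ i) j +ᶻ z *ᶻ s (m ∸ suc i) j) (neg^-falling-suc m i) ⟨
    a *ᶻ s (m ∸ i) j +ᶻ neg^ (suc i) (+ falling m (suc i)) *ᶻ s (m ∸ suc i) j
  ∎
  where
  open ≡-Reasoning
  a = neg^ i (+ fallingQuot m i)
  expand : ∀ a x L y → a *ᶻ (x - L *ᶻ y) ≡ a *ᶻ x +ᶻ - (L *ᶻ a) *ᶻ y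
  expand = solve-∀

-- Coefficientwise form of  d/dx (x)ₘ = Σᵢ (−1)ⁱ ((m)ᵢ₊₁ / (i + 1)) (x)ₘ₋₁₋ᵢ ,
-- proved through (x)ₘ₊₁ = (x − m) (x)ₘ and the Leibniz rule.
stirling1-deriv : ∀ m j →
  deriv (s m) j ≡ ∑ m (λ i → neg^ i (+ fallingQuot m i) *ᶻ s (m ∸ suc i) j)
stirling1-deriv zero    j = ℤ.*-zeroʳ (+ suc j)
stirling1-deriv (suc m) j = begin
    deriv (xMinus m (s m)) j
  ≡⟨ deriv-xMinus m (s m) j ⟩
    s m j +ᶻ xMinus m (deriv (s m)) j
  ≡⟨ cong (s m j +ᶻ_) (trans (xMinus-cong m (stirling1-deriv m) j) (xMinus-∑ m m a (λ i → s (m ∸ suc i)) j)) ⟩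
    s m j +ᶻ ∑ m (λ i → a i *ᶻ xMinus m (s (m ∸ suc i)) j)
  ≡⟨ cong (s m j +ᶻ_) (trans (∑-cong< m (fallingQuot-xMinus m j)) (∑-+ m _ _)) ⟩
    s m j +ᶻ (∑ m (λ i → a i *ᶻ S i) +ᶻ ∑ m (λ i → b (suc i) *ᶻ S (suc i)))
  ≡⟨ regroup (s m j) (∑ m (λ i → a i *ᶻ S i)) (∑ m (λ i → b (suc i) *ᶻ S (suc i))) ⟩
    (∑ m (λ i → a i *ᶻ S i) +ᶻ + 0) +ᶻ ∑ (suc m) (λ i → b i *ᶻ S i)
  ≡⟨ cong (λ z → (∑ m (λ i → a i *ᶻ S i) +ᶻ z) +ᶻ ∑ (suc m) (λ i → b i *ᶻ S i)) last-vanishes ⟨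
    (∑ m (λ i → a i *ᶻ S i) +ᶻ a m *ᶻ S m) +ᶻ ∑ (suc m) (λ i → b i *ᶻ S i)
  ≡⟨ cong (_+ᶻ ∑ (suc m) (λ i → b i *ᶻ S i)) (∑-init-last m (λ i → a i *ᶻ S i)) ⟨
    ∑ (suc m) (λ i → a i *ᶻ S i) +ᶻ ∑ (suc m) (λ i → b i *ᶻ S i)
  ≡⟨ trans (∑-cong (suc m) merge) (∑-+ (suc m) (λ i → a i *ᶻ S i) (λ i → b i *ᶻ S i)) ⟨
    ∑ (suc m) (λ i → neg^ i (+ fallingQuot (suc m) i) *ᶻ S i)
  ∎
  where
  open ≡-Reasoning
  a b S : ℕ → ℤ
  a i = neg^ i (+ fallingQuot m i)
  b i = neg^ i (+ falling m i)
  S i = s (m ∸ i) j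
  regroup : ∀ x A B → x +ᶻ (A +ᶻ B) ≡ (A +ᶻ + 0) +ᶻ (+ 1 *ᶻ x +ᶻ B)
  regroup = solve-∀
  last-vanishes : a m *ᶻ S m ≡ + 0
  last-vanishes = trans (cong (λ x → neg^ m (+ x) *ᶻ S m) (fallingQuot-self m)) (cong (_*ᶻ S m) (neg^-zero m))
  merge : ∀ i → neg^ i (+ fallingQuot (suc m) i) *ᶻ S i ≡ a i *ᶻ S i +ᶻ b i *ᶻ S i
  merge i = trans (cong (λ z → neg^ i z *ᶻ S i) (ℤ.pos-+ (fallingQuot m i) (falling m i)))
           (trans (cong (_*ᶻ S i) (neg^-+ i _ _)) (ℤ.*-distribʳ-+ (S i) (a i) (b i)))

shiftedFalling : ℕ → ℕ → ℕ → ℤ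
shiftedFalling t zero    = one
shiftedFalling t (suc N) = xMinus (t + suc N) (shiftedFalling t N)

shiftedFalling-monic : ∀ t N → Monic N (shiftedFalling t N)
shiftedFalling-monic t zero    = one-monic
shiftedFalling-monic t (suc N) = xMinus-monic (t + suc N) (shiftedFalling-monic t N)

stirling1-conv : ∀ t N K → s (suc t + N) K ≡ conv (s (suc t)) (shiftedFalling t N) K
stirling1-conv t zero    K = trans (cong (λ n → s n K) (ℕ.+-identityʳ (suc t))) (sym (conv-oneʳ (s (suc t)) K))
stirling1-conv t (suc N) K = begin
    s (suc t + suc N) K
  ≡⟨ cong (λ n → s n K) (ℕ.+-suc (suc t) N) ⟩
    s (suc (suc t + N)) K
  ≡⟨ stirling1-suc (suc t + N) K ⟩
    xMinus (suc t + N) (s (suc t + N)) K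
  ≡⟨ xMinus-cong (suc t + N) (stirling1-conv t N) K ⟩
    xMinus (suc t + N) (conv (s (suc t)) (shiftedFalling t N)) K
  ≡⟨ cong (λ c → xMinus c (conv (s (suc t)) (shiftedFalling t N)) K) (ℕ.+-suc t N) ⟨
    xMinus (t + suc N) (conv (s (suc t)) (shiftedFalling t N)) K
  ≡⟨ conv-xMinus (t + suc N) (s (suc t)) (shiftedFalling t N) K ⟨
    conv (s (suc t)) (shiftedFalling t (suc N)) K
  ∎
  where open ≡-Reasoning

shiftedFalling-translate : ∀ t N B → N < B → ∀ l → shiftedFalling t N l ≡ translate t B (shiftedFalling 0 N) l
shiftedFalling-translate t zero (suc B) _ l =
  sym (trans (cong₂ _+ᶻ_ (ℤ.*-identityˡ (one l)) (∑-zero B (λ _ _ → refl))) (ℤ.+-identityʳ (one l)))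
shiftedFalling-translate t (suc N) (suc B) (s≤s N<B) l = begin
    xMinus (t + suc N) (shiftedFalling t N) l
  ≡⟨ xMinus-cong (t + suc N) (shiftedFalling-translate t N B N<B) l ⟩
    xMinus (t + suc N) (translate t B (shiftedFalling 0 N)) l
  ≡⟨ translate-xMinus t (suc N) B (shiftedFalling 0 N) (proj₁ (shiftedFalling-monic 0 N) B N<B) l ⟨
    translate t (suc B) (shiftedFalling 0 (suc N)) l
  ∎
  where open ≡-Reasoning

shiftedFalling-zero : ∀ N l → shiftedFalling 0 N l ≡ s (suc N) (suc l)
shiftedFalling-zero zero    zero    = refl
shiftedFalling-zero zero    (suc l) = refl
shiftedFalling-zero (suc N) l = cong₂ (λ a b → a - + suc N *ᶻ b) (lowered l) (shiftedFalling-zero N l)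
  where
  lowered : ∀ l → mulX (shiftedFalling 0 N) l ≡ s (suc N) l
  lowered zero    = refl
  lowered (suc l) = shiftedFalling-zero N l

-- Valuations and digit sums in base p

-- The base is p = r + 2, so that p ≥ 2 by construction and p ∸ 1 computes to q.
module Radix (r : ℕ) where

  p q : ℕ
  p = suc (suc r)
  q = suc r

  1<p : 1 < p
  1<p = s≤s (s≤s z≤n)

  p^≢0 : ∀ e → p ^ e ≢ 0
  p^≢0 e = ℕ.≢-nonZero⁻¹ (p ^ e) {{ℕ.m^n≢0 p e}}

  m<p^m : ∀ m → m < p ^ m
  m<p^m zero    = s≤s z≤n
  m<p^m (suc m) = ℕ.≤-trans (ℕ.+-mono-≤ (ℕ.m^n>0 p m) (m<p^m m))
                            (ℕ.+-monoʳ-≤ (p ^ m) (ℕ.m≤m+n (p ^ m) (r * p ^ m)))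

  ν-div : ∀ x → p ^ ν p x ℕ.∣ x
  ν-div x = search x
    where
    search : ∀ f → p ^ νAux p x f ℕ.∣ x
    search zero    = ℕ.1∣ x
    search (suc f) with p ^ suc f ∣? x
    ... | yes d = d
    ... | no  _ = search f

  ν-max : ∀ {x m} → x ≢ 0 → p ^ m ℕ.∣ x → m ≤ ν p x
  ν-max {x} {m} x≢0 d = search x m (ℕ.<⇒≤ (ℕ.<-≤-trans (m<p^m m) (ℕ.∣⇒≤ {{ℕ.≢-nonZero x≢0}} d))) d
    where
    search : ∀ f m → m ≤ f → p ^ m ℕ.∣ x → m ≤ νAux p x f
    search zero    .0 z≤n _ = z≤n
    search (suc f) m m≤ d′ with p ^ suc f ∣? x
    ... | yes _ = m≤
    ... | no ¬d with ℕ.m≤n⇒m<n∨m≡n m≤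
    ...   | inj₁ m<sf = search f m (ℕ.≤-pred m<sf) d′
    ...   | inj₂ refl = ⊥-elim (¬d d′)

  ν-exact : ∀ x e u → x ≡ p ^ e * u → ¬ p ℕ.∣ u → ν p x ≡ e
  ν-exact x e u x≡ p∤u = ℕ.≤-antisym upper lower
    where
    x≢0 : x ≢ 0
    x≢0 x≡0 with ℕ.m*n≡0⇒m≡0∨n≡0 (p ^ e) (trans (sym x≡) x≡0)
    ... | inj₁ p^e≡0 = p^≢0 e p^e≡0
    ... | inj₂ u≡0   = p∤u (subst (p ℕ.∣_) (sym u≡0) (p ℕ.∣0))
    lower : e ≤ ν p x
    lower = ν-max x≢0 (divides u (trans x≡ (ℕ.*-comm (p ^ e) u)))
    upper : ν p x ≤ e
    upper with ν p x ℕ.≤? e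
    ... | yes ν≤e = ν≤e
    ... | no  ν≰e = ⊥-elim (p∤u (ℕ.*-cancelˡ-∣ (p ^ e) {{ℕ.m^n≢0 p e}} p^e*p∣p^e*u))
      where
      p^e*p∣p^e*u : p ^ e * p ℕ.∣ p ^ e * u
      p^e*p∣p^e*u = subst₂ ℕ._∣_ (ℕ.*-comm p (p ^ e)) x≡ (ℕ.∣-trans (^-monoʳ-∣ p (ℕ.≰⇒> ν≰e)) (ν-div x))

  ν-decomp : ∀ x → x ≢ 0 → Σ[ u ∈ ℕ ] (x ≡ p ^ ν p x * u × ¬ p ℕ.∣ u)
  ν-decomp x x≢0 with ν-div x
  ... | divides u x≡u*p^ν = u , trans x≡u*p^ν (ℕ.*-comm u (p ^ ν p x)) , p∤u
    where
    p∤u : ¬ p ℕ.∣ u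
    p∤u (divides w u≡w*p) = ℕ.<-irrefl refl (ν-max x≢0 (divides w (trans x≡u*p^ν
      (trans (cong (_* p ^ ν p x) u≡w*p) (ℕ.*-assoc w p (p ^ ν p x))))))

  ν-*p : ∀ y → y ≢ 0 → ν p (y * p) ≡ suc (ν p y)
  ν-*p y y≢0 with ν-decomp y y≢0
  ... | u , y≡ , p∤u = ν-exact (y * p) (suc (ν p y)) u
          (trans (cong (_* p) y≡) (rearrange (p ^ ν p y) u p)) p∤u
    where
    rearrange : ∀ a u p → a * u * p ≡ p * a * u
    rearrange = ℕ.solve-∀

  ν-coprime : ∀ y → ¬ p ℕ.∣ y → ν p y ≡ 0
  ν-coprime y p∤y = ν-exact y 0 y (sym (ℕ.+-identityʳ y)) p∤y

  ν-< : ∀ a x → 0 < x → x < p ^ suc a → ν p x ≤ a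
  ν-< a x 0<x x<p^1+a with ν p x ℕ.≤? a
  ... | yes ν≤a = ν≤a
  ... | no  ν≰a = ⊥-elim (ℕ.<-irrefl refl (ℕ.<-≤-trans x<p^1+a
          (ℕ.≤-trans (ℕ.^-monoʳ-≤ p (ℕ.≰⇒> ν≰a)) (ℕ.∣⇒≤ {{ℕ.>-nonZero 0<x}} (ν-div x)))))

  q*e<p^e : ∀ e → q * e < p ^ e
  q*e<p^e zero    = subst (_< 1) (sym (ℕ.*-zeroʳ q)) (s≤s z≤n)
  q*e<p^e (suc e) = begin-strict
      q * suc e
    ≡⟨ ℕ.*-suc q e ⟩
      q + q * e
    <⟨ ℕ.+-mono-≤-< (ℕ.m≤m*n q (p ^ e) {{ℕ.m^n≢0 p e}}) (q*e<p^e e) ⟩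
      q * p ^ e + p ^ e
    ≡⟨ ℕ.+-comm (q * p ^ e) (p ^ e) ⟩
      p ^ suc e
    ∎
    where open ℕ.≤-Reasoning

  q*ν[1+i]≤i : ∀ i → q * ν p (suc i) ≤ i
  q*ν[1+i]≤i i = ℕ.≤-pred (ℕ.<-≤-trans (q*e<p^e (ν p (suc i))) (ℕ.∣⇒≤ (ν-div (suc i))))

  σAux-zero : ∀ f → σAux p f 0 ≡ 0
  σAux-zero zero    = refl
  σAux-zero (suc f) = σAux-zero f

  σAux-fuel : ∀ f g x → x ≤ f → x ≤ g → σAux p f x ≡ σAux p g x
  σAux-fuel zero    zero    x  _   _   = refl
  σAux-fuel zero    (suc g) .0 z≤n _   = sym (σAux-zero (suc g))
  σAux-fuel (suc f) zero    .0 _   z≤n = σAux-zero (suc f)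
  σAux-fuel (suc f) (suc g) x  x≤f x≤g = cong (_+_ (x % p)) (σAux-fuel f g (x / p) (/p≤ x≤f) (/p≤ x≤g))
    where
    /p≤ : ∀ {x f} → x ≤ suc f → x / p ≤ f
    /p≤ {zero}  _   = z≤n
    /p≤ {suc x} x≤f = ℕ.≤-pred (ℕ.<-≤-trans (ℕ.m/n<m (suc x) p 1<p) x≤f)

  σ-+-*p : ∀ d y → d < p → σ p (d + y * p) ≡ d + σ p y
  σ-+-*p d y d<p = begin
      σAux p x x
    ≡⟨ σAux-fuel x (suc x) x ℕ.≤-refl (ℕ.n≤1+n x) ⟩
      x % p + σAux p x (x / p)
    ≡⟨ cong₂ (λ a b → a + σAux p x b) x%p≡d x/p≡y ⟩
      d + σAux p x y
    ≡⟨ cong (_+_ d) (σAux-fuel x y y (ℕ.≤-trans (ℕ.m≤m*n y p) (ℕ.m≤n+m (y * p) d)) ℕ.≤-refl) ⟩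
      d + σ p y
    ∎
    where
    open ≡-Reasoning
    x = d + y * p
    x%p≡d : x % p ≡ d
    x%p≡d = trans (ℕ.[m+kn]%n≡m%n d y p) (ℕ.m<n⇒m%n≡m d<p)
    x/p≡y : x / p ≡ y
    x/p≡y = trans (ℕ.+-distrib-/-∣ʳ d (ℕ.n∣m*n y)) (cong₂ _+_ (ℕ.m<n⇒m/n≡0 d<p) (ℕ.m*n/n≡m y p))

  σ-%-/ : ∀ x → σ p x ≡ x % p + σ p (x / p)
  σ-%-/ x = trans (cong (σ p) (ℕ.m≡m%n+[m/n]*n x p)) (σ-+-*p (x % p) (x / p) (ℕ.m%n<n x p))

  DigitSumStep : ℕ → Set
  DigitSumStep m = σ p (suc m) + q * ν p (suc m) ≡ σ p m + 1

  digitSumStep-lastDigit≢0 : ∀ d y → suc d < p → DigitSumStep (d + y * p)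
  digitSumStep-lastDigit≢0 d y 1+d<p = begin
      σ p (suc d + y * p) + q * ν p (suc d + y * p)
    ≡⟨ cong (λ v → σ p (suc d + y * p) + q * v) (ν-coprime (suc d + y * p) p∤) ⟩
      σ p (suc d + y * p) + q * 0
    ≡⟨ trans (cong (_+_ (σ p (suc d + y * p))) (ℕ.*-zeroʳ q)) (ℕ.+-identityʳ _) ⟩
      σ p (suc d + y * p)
    ≡⟨ σ-+-*p (suc d) y 1+d<p ⟩
      suc d + σ p y
    ≡⟨ ℕ.+-comm 1 (d + σ p y) ⟩
      d + σ p y + 1
    ≡⟨ cong (_+ 1) (σ-+-*p d y (ℕ.<-trans (ℕ.n<1+n d) 1+d<p)) ⟨
      σ p (d + y * p) + 1
    ∎
    where
    open ≡-Reasoning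
    p∤ : ¬ p ℕ.∣ suc d + y * p
    p∤ p∣ with trans (sym (trans (ℕ.[m+kn]%n≡m%n (suc d) y p) (ℕ.m<n⇒m%n≡m 1+d<p))) (ℕ.n∣m⇒m%n≡0 _ p p∣)
    ... | ()

  digitSumStep-lastDigit≡0 : ∀ y → DigitSumStep y → DigitSumStep (q + y * p)
  digitSumStep-lastDigit≡0 y step = begin
      σ p (0 + suc y * p) + q * ν p (suc y * p)
    ≡⟨ cong₂ (λ a b → a + q * b) (σ-+-*p 0 (suc y) (s≤s z≤n)) (ν-*p (suc y) (λ ())) ⟩
      σ p (suc y) + q * suc (ν p (suc y))
    ≡⟨ carry (σ p (suc y)) q (ν p (suc y)) ⟩
      σ p (suc y) + q * ν p (suc y) + q
    ≡⟨ cong (_+ q) step ⟩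
      σ p y + 1 + q
    ≡⟨ regroup (σ p y) q ⟩
      q + σ p y + 1
    ≡⟨ cong (_+ 1) (σ-+-*p q y (ℕ.n<1+n q)) ⟨
      σ p (q + y * p) + 1
    ∎
    where
    open ≡-Reasoning
    carry : ∀ s q v → s + q * suc v ≡ s + q * v + q
    carry = ℕ.solve-∀
    regroup : ∀ s q → s + 1 + q ≡ q + s + 1
    regroup = ℕ.solve-∀

  σ-suc : ∀ m → DigitSumStep m
  σ-suc m = go (suc m) m (ℕ.n<1+n m)
    where
    go : ∀ F m → m < F → DigitSumStep m
    go (suc F) m (s≤s m≤F) = byDigits (suc m % p) (suc m / p) (ℕ.m≡m%n+[m/n]*n (suc m) p) (ℕ.m%n<n (suc m) p)
      where
      byDigits : ∀ d y → suc m ≡ d + y * p → d < p → DigitSumStep m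
      byDigits (suc d) y 1+m≡ d<p = subst DigitSumStep (sym (ℕ.suc-injective 1+m≡)) (digitSumStep-lastDigit≢0 d y d<p)
      byDigits zero    (suc y) 1+m≡ _ = subst DigitSumStep (sym m≡) (digitSumStep-lastDigit≡0 y (go F y y<F))
        where
        m≡ : m ≡ q + y * p
        m≡ = ℕ.suc-injective 1+m≡
        y<F : y < F
        y<F = ℕ.<-≤-trans (s≤s (ℕ.≤-trans (ℕ.m≤m*n y p) (ℕ.m≤n+m (y * p) r))) (subst (_≤ F) m≡ m≤F)

  σ-suc-≤ : ∀ m → σ p (suc m) ≤ σ p m + 1
  σ-suc-≤ m = subst (σ p (suc m) ≤_) (σ-suc m) (ℕ.m≤m+n (σ p (suc m)) _)

  /p-< : ∀ {a x} → x < p ^ suc a → x / p < p ^ a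
  /p-< {a} {x} x<p^1+a = ℕ.m<n*o⇒m/o<n (subst (x <_) (ℕ.*-comm p (p ^ a)) x<p^1+a)

  σ-+-*p^ : ∀ a x y → x < p ^ a → σ p (x + y * p ^ a) ≡ σ p x + σ p y
  σ-+-*p^ zero    zero    y _         = cong (σ p) (ℕ.*-identityʳ y)
  σ-+-*p^ zero    (suc x) y (s≤s ())
  σ-+-*p^ (suc a) x       y x<p^1+a = begin
      σ p (x + y * p ^ suc a)
    ≡⟨ cong (σ p) (trans (cong (_+ y * p ^ suc a) (ℕ.m≡m%n+[m/n]*n x p)) (regroup (x % p) (x / p) y (p ^ a) p)) ⟩
      σ p (x % p + (x / p + y * p ^ a) * p)
    ≡⟨ σ-+-*p (x % p) (x / p + y * p ^ a) (ℕ.m%n<n x p) ⟩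
      x % p + σ p (x / p + y * p ^ a)
    ≡⟨ cong (_+_ (x % p)) (σ-+-*p^ a (x / p) y (/p-< {a} x<p^1+a)) ⟩
      x % p + (σ p (x / p) + σ p y)
    ≡⟨ ℕ.+-assoc (x % p) _ _ ⟨
      x % p + σ p (x / p) + σ p y
    ≡⟨ cong (_+ σ p y) (σ-%-/ x) ⟨
      σ p x + σ p y
    ∎
    where
    open ≡-Reasoning
    regroup : ∀ x₀ x₁ y P p → (x₀ + x₁ * p) + y * (p * P) ≡ x₀ + (x₁ + y * P) * p
    regroup = ℕ.solve-∀

  σ-+-*p-carry : ∀ u₀ w₀ v → u₀ < p → w₀ < p → p ≤ u₀ + w₀ →
                 σ p ((u₀ + w₀) + v * p) + q ≤ (u₀ + w₀) + σ p v
  σ-+-*p-carry u₀ w₀ v u₀<p w₀<p p≤ = begin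
      σ p ((u₀ + w₀) + v * p) + q
    ≡⟨ cong (λ x → σ p x + q) (trans (cong (_+ v * p) u₀+w₀≡) (regroup p e v)) ⟩
      σ p (e + suc v * p) + q
    ≡⟨ cong (_+ q) (σ-+-*p e (suc v) e<p) ⟩
      e + σ p (suc v) + q
    ≤⟨ ℕ.+-monoˡ-≤ q (ℕ.+-monoʳ-≤ e (σ-suc-≤ v)) ⟩
      e + (σ p v + 1) + q
    ≡⟨ regroup′ e (σ p v) r ⟩
      (p + e) + σ p v
    ≡⟨ cong (_+ σ p v) u₀+w₀≡ ⟨
      (u₀ + w₀) + σ p v
    ∎
    where
    open ℕ.≤-Reasoning
    e = (u₀ + w₀) ∸ p
    u₀+w₀≡ : u₀ + w₀ ≡ p + e
    u₀+w₀≡ = sym (ℕ.m+[n∸m]≡n p≤)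
    e<p : e < p
    e<p = ℕ.+-cancelˡ-< p e p (subst (_< p + p) u₀+w₀≡ (ℕ.+-mono-< u₀<p w₀<p))
    regroup : ∀ p e v → (p + e) + v * p ≡ e + (1 + v) * p
    regroup = ℕ.solve-∀
    regroup′ : ∀ e s r → e + (s + 1) + suc r ≡ (suc (suc r) + e) + s
    regroup′ = ℕ.solve-∀

  σ-+-*p-≤ : ∀ u₀ w₀ v → u₀ < p → w₀ < p → σ p ((u₀ + w₀) + v * p) ≤ (u₀ + w₀) + σ p v
  σ-+-*p-≤ u₀ w₀ v u₀<p w₀<p with (u₀ + w₀) ℕ.<? p
  ... | yes no-carry = ℕ.≤-reflexive (σ-+-*p (u₀ + w₀) v no-carry)
  ... | no  carry    = ℕ.≤-trans (ℕ.m≤m+n _ q) (σ-+-*p-carry u₀ w₀ v u₀<p w₀<p (ℕ.≮⇒≥ carry))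

  digits-+ : ∀ u w → u + w ≡ (u % p + w % p) + (u / p + w / p) * p
  digits-+ u w = trans (cong₂ _+_ (ℕ.m≡m%n+[m/n]*n u p) (ℕ.m≡m%n+[m/n]*n w p))
                       (interchange (u % p) (u / p) (w % p) (w / p) p)
    where
    interchange : ∀ u₀ u₁ w₀ w₁ p → (u₀ + u₁ * p) + (w₀ + w₁ * p) ≡ (u₀ + w₀) + (u₁ + w₁) * p
    interchange = ℕ.solve-∀

  σ+σ-digits : ∀ u w → σ p u + σ p w ≡ (u % p + w % p) + (σ p (u / p) + σ p (w / p))
  σ+σ-digits u w = trans (cong₂ _+_ (σ-%-/ u) (σ-%-/ w)) (interchange (u % p) (σ p (u / p)) (w % p) (σ p (w / p)))
    where
    interchange : ∀ a b c d → (a + b) + (c + d) ≡ (a + c) + (b + d)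
    interchange = ℕ.solve-∀

  σ-+-≤ : ∀ a u w → u < p ^ a → w < p ^ a → σ p (u + w) ≤ σ p u + σ p w
  σ-+-≤ zero    zero    zero    _         _ = ℕ.≤-refl
  σ-+-≤ zero    (suc u) w       (s≤s ()) _
  σ-+-≤ zero    zero    (suc w) _         (s≤s ())
  σ-+-≤ (suc a) u       w       u<p^1+a   w<p^1+a = begin
      σ p (u + w)
    ≡⟨ cong (σ p) (digits-+ u w) ⟩
      σ p ((u % p + w % p) + (u / p + w / p) * p)
    ≤⟨ σ-+-*p-≤ (u % p) (w % p) (u / p + w / p) (ℕ.m%n<n u p) (ℕ.m%n<n w p) ⟩
      (u % p + w % p) + σ p (u / p + w / p)
    ≤⟨ ℕ.+-monoʳ-≤ (u % p + w % p) (σ-+-≤ a (u / p) (w / p) (/p-< {a} u<p^1+a) (/p-< {a} w<p^1+a)) ⟩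
      (u % p + w % p) + (σ p (u / p) + σ p (w / p))
    ≡⟨ σ+σ-digits u w ⟨
      σ p u + σ p w
    ∎
    where open ℕ.≤-Reasoning

  carry-propagates : ∀ a u w → p ^ suc a ≤ u + w → u % p + w % p < p → p ^ a ≤ u / p + w / p
  carry-propagates a u w p^1+a≤u+w no-carry = ℕ.≤-pred (ℕ.*-cancelʳ-< p (p ^ a) (suc v) (begin-strict
      p ^ a * p
    ≡⟨ ℕ.*-comm (p ^ a) p ⟩
      p ^ suc a
    ≤⟨ p^1+a≤u+w ⟩
      u + w
    ≡⟨ digits-+ u w ⟩
      (u % p + w % p) + v * p
    <⟨ ℕ.+-monoˡ-< (v * p) no-carry ⟩
      suc v * p
    ∎))
    where
    open ℕ.≤-Reasoning
    v = u / p + w / p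

  σ-+-carry : ∀ a u w → u < p ^ a → w < p ^ a → p ^ a ≤ u + w → σ p (u + w) + q ≤ σ p u + σ p w
  σ-+-carry zero    zero    zero    _         _ ()
  σ-+-carry zero    (suc u) w       (s≤s ()) _ _
  σ-+-carry zero    zero    (suc w) _         (s≤s ()) _
  σ-+-carry (suc a) u       w       u<p^1+a   w<p^1+a p^1+a≤u+w = byLowDigits ((u₀ + w₀) ℕ.<? p)
    where
    open ℕ.≤-Reasoning
    u₀ = u % p
    w₀ = w % p
    v = u / p + w / p
    byLowDigits : Dec (u₀ + w₀ < p) → σ p (u + w) + q ≤ σ p u + σ p w
    byLowDigits (yes no-carry) = begin
        σ p (u + w) + q
      ≡⟨ cong (λ x → σ p x + q) (digits-+ u w) ⟩
        σ p ((u₀ + w₀) + v * p) + q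
      ≡⟨ cong (_+ q) (σ-+-*p (u₀ + w₀) v no-carry) ⟩
        (u₀ + w₀) + σ p v + q
      ≡⟨ ℕ.+-assoc (u₀ + w₀) (σ p v) q ⟩
        (u₀ + w₀) + (σ p v + q)
      ≤⟨ ℕ.+-monoʳ-≤ (u₀ + w₀) (σ-+-carry a (u / p) (w / p) (/p-< {a} u<p^1+a) (/p-< {a} w<p^1+a)
                                           (carry-propagates a u w p^1+a≤u+w no-carry)) ⟩
        (u₀ + w₀) + (σ p (u / p) + σ p (w / p))
      ≡⟨ σ+σ-digits u w ⟨
        σ p u + σ p w
      ∎
    byLowDigits (no carry) = begin
        σ p (u + w) + q
      ≡⟨ cong (λ x → σ p x + q) (digits-+ u w) ⟩
        σ p ((u₀ + w₀) + v * p) + q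
      ≤⟨ σ-+-*p-carry u₀ w₀ v (ℕ.m%n<n u p) (ℕ.m%n<n w p) (ℕ.≮⇒≥ carry) ⟩
        (u₀ + w₀) + σ p v
      ≤⟨ ℕ.+-monoʳ-≤ (u₀ + w₀) (σ-+-≤ a (u / p) (w / p) (/p-< {a} u<p^1+a) (/p-< {a} w<p^1+a)) ⟩
        (u₀ + w₀) + (σ p (u / p) + σ p (w / p))
      ≡⟨ σ+σ-digits u w ⟨
        σ p u + σ p w
      ∎

  σ-≤-σ-suc : ∀ a x → suc x < p ^ suc a → σ p x ≤ σ p (suc x) + q * a
  σ-≤-σ-suc a x 1+x<p^1+a = begin
      σ p x
    ≤⟨ ℕ.m≤m+n (σ p x) 1 ⟩
      σ p x + 1
    ≡⟨ σ-suc x ⟨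
      σ p (suc x) + q * ν p (suc x)
    ≤⟨ ℕ.+-monoʳ-≤ (σ p (suc x)) (ℕ.*-monoʳ-≤ q (ν-< a (suc x) (s≤s z≤n) 1+x<p^1+a)) ⟩
      σ p (suc x) + q * a
    ∎
    where open ℕ.≤-Reasoning

  σl≤σ[l+k]+q*a*k : ∀ a k l → l + k < p ^ suc a → σ p l ≤ σ p (l + k) + q * a * k
  σl≤σ[l+k]+q*a*k a zero    l _ =
    ℕ.≤-reflexive (sym (trans (cong₂ _+_ (cong (σ p) (ℕ.+-identityʳ l)) (ℕ.*-zeroʳ (q * a))) (ℕ.+-identityʳ (σ p l))))
  σl≤σ[l+k]+q*a*k a (suc k) l l+1+k<p^1+a = begin
      σ p l
    ≤⟨ σl≤σ[l+k]+q*a*k a k l (ℕ.<-trans (ℕ.+-monoʳ-< l (ℕ.n<1+n k)) l+1+k<p^1+a) ⟩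
      σ p (l + k) + q * a * k
    ≤⟨ ℕ.+-monoˡ-≤ (q * a * k) (σ-≤-σ-suc a (l + k) (subst (_< p ^ suc a) (ℕ.+-suc l k) l+1+k<p^1+a)) ⟩
      σ p (suc (l + k)) + q * a + q * a * k
    ≡⟨ regroup (σ p (suc (l + k))) (q * a) k ⟩
      σ p (suc (l + k)) + q * a * suc k
    ≡⟨ cong (λ x → σ p x + q * a * suc k) (ℕ.+-suc l k) ⟨
      σ p (l + suc k) + q * a * suc k
    ∎
    where
    open ℕ.≤-Reasoning
    regroup : ∀ s Q k → s + Q + Q * k ≡ s + Q * suc k
    regroup = ℕ.solve-∀

  σl+q≤σi+q*[1+a]*[i∸l] : ∀ a l i → l < i → i < p ^ suc a → σ p l + q ≤ σ p i + q * (suc a * (i ∸ l))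
  σl+q≤σi+q*[1+a]*[i∸l] a l i l<i i<p^1+a = begin
      σ p l + q
    ≤⟨ ℕ.+-monoˡ-≤ q (subst (λ x → σ p l ≤ σ p x + q * a * k) l+k≡i
         (σl≤σ[l+k]+q*a*k a k l (subst (_< p ^ suc a) (sym l+k≡i) i<p^1+a))) ⟩
      σ p i + q * a * k + q
    ≡⟨ ℕ.+-assoc (σ p i) _ q ⟩
      σ p i + (q * a * k + q)
    ≤⟨ ℕ.+-monoʳ-≤ (σ p i) (gain k (ℕ.m<n⇒0<n∸m l<i)) ⟩
      σ p i + q * (suc a * k)
    ∎
    where
    open ℕ.≤-Reasoning
    k = i ∸ l
    l+k≡i : l + k ≡ i
    l+k≡i = ℕ.m+[n∸m]≡n (ℕ.<⇒≤ l<i)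
    gain : ∀ k → 0 < k → q * a * k + q ≤ q * (suc a * k)
    gain (suc k) _ = subst (q * a * suc k + q ≤_) (sym (expand q a k)) (ℕ.m≤m+n _ (q * k))
      where
      expand : ∀ q a k → q * (suc a * suc k) ≡ (q * a * suc k + q) + q * k
      expand = ℕ.solve-∀

  offDiagonal-digits : ∀ P m {M c j} → c < suc m * P → c + j ≡ suc m * P + M → j < P →
                       Σ[ u ∈ ℕ ] (u < P × M < P × c ≡ u + m * P × u + j ≡ M + 1 * P)
  offDiagonal-digits P m {M} {c} {j} c<t c+j≡t+M j<P = P ∸ d , u<P , M<P , c≡u+m*P , u+j≡M+1*P
    where
    d u : ℕ
    d = suc m * P ∸ c
    u = P ∸ d
    c+d≡t : c + d ≡ suc m * P
    c+d≡t = ℕ.m+[n∸m]≡n (ℕ.<⇒≤ c<t)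
    j≡d+M : j ≡ d + M
    j≡d+M = ℕ.+-cancelˡ-≡ c j (d + M) (trans c+j≡t+M (trans (cong (_+ M) (sym c+d≡t)) (ℕ.+-assoc c d M)))
    d≤P : d ≤ P
    d≤P = ℕ.<⇒≤ (ℕ.≤-<-trans (subst (d ≤_) (sym j≡d+M) (ℕ.m≤m+n d M)) j<P)
    u+d≡P : u + d ≡ P
    u+d≡P = ℕ.m∸n+n≡m d≤P
    u<P : u < P
    u<P = subst (u <_) u+d≡P (ℕ.m<m+n u (ℕ.m<n⇒0<n∸m c<t))
    M<P : M < P
    M<P = ℕ.≤-<-trans (subst (M ≤_) (sym j≡d+M) (ℕ.m≤n+m M d)) j<P
    c≡u+m*P : c ≡ u + m * P
    c≡u+m*P = ℕ.+-cancelʳ-≡ d c (u + m * P) (trans c+d≡t (trans (cong (_+ m * P) (sym u+d≡P)) (swap u d (m * P))))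
      where
      swap : ∀ u d x → u + d + x ≡ u + x + d
      swap = ℕ.solve-∀
    u+j≡M+1*P : u + j ≡ M + 1 * P
    u+j≡M+1*P = trans (cong (_+_ u) j≡d+M) (trans (sym (ℕ.+-assoc u d M)) (trans (cong (_+ M) u+d≡P) (swap P M)))
      where
      swap : ∀ P M → P + M ≡ M + 1 * P
      swap = ℕ.solve-∀

  σ-offDiagonal : ∀ a m {M c j} → c < suc m * p ^ a → c + j ≡ suc m * p ^ a + M → j < p ^ a →
                  σ p M + q + σ p (suc m * p ^ a) ≤ σ p j + σ p c
  σ-offDiagonal a m {M} {c} {j} c<t c+j≡t+M j<P with offDiagonal-digits (p ^ a) m c<t c+j≡t+M j<P
  ... | u , u<P , M<P , c≡u+m*P , u+j≡M+1*P = begin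
      σ p M + q + σ p (suc m * p ^ a)
    ≤⟨ ℕ.+-monoʳ-≤ (σ p M + q) σt≤ ⟩
      σ p M + q + (σ p m + 1)
    ≡⟨ regroup (σ p M) q (σ p m) ⟩
      σ p M + 1 + q + σ p m
    ≡⟨ cong (λ z → z + q + σ p m) (trans (cong (σ p) u+j≡M+1*P) (σ-+-*p^ a M 1 M<P)) ⟨
      σ p (u + j) + q + σ p m
    ≤⟨ ℕ.+-monoˡ-≤ (σ p m) (σ-+-carry a u j u<P j<P P≤u+j) ⟩
      σ p u + σ p j + σ p m
    ≡⟨ regroup′ (σ p u) (σ p j) (σ p m) ⟩
      σ p j + (σ p u + σ p m)
    ≡⟨ cong (_+_ (σ p j)) (trans (cong (σ p) c≡u+m*P) (σ-+-*p^ a u m u<P)) ⟨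
      σ p j + σ p c
    ∎
    where
    open ℕ.≤-Reasoning
    P≤u+j : p ^ a ≤ u + j
    P≤u+j = subst (p ^ a ≤_) (trans (cong (_+_ M) (sym (ℕ.*-identityˡ (p ^ a)))) (sym u+j≡M+1*P)) (ℕ.m≤n+m (p ^ a) M)
    σt≤ : σ p (suc m * p ^ a) ≤ σ p m + 1
    σt≤ = subst (_≤ σ p m + 1) (sym (σ-+-*p^ a 0 (suc m) (ℕ.m^n>0 p a))) (σ-suc-≤ m)
    regroup : ∀ a q b → a + q + (b + 1) ≡ a + 1 + q + b
    regroup = ℕ.solve-∀
    regroup′ : ∀ a b c → a + b + c ≡ b + (a + c)
    regroup′ = ℕ.solve-∀

ShiftedMinZeroCase : ℕ → ℕ → ℕ → ℕ → Set
ShiftedMinZeroCase p n k t =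
  MinZeroCase p (t + n) (t + k)
  × νℤ p (stirling1 (t + n) (t + k)) ≡ νℤ p (stirling1 n k)
  × (+ p) ∣ (ε p (stirling1 (t + n) (t + k)) - ε p (stirling1 n k))

module PrimeRadix (r : ℕ) (p-prime : Prime (suc (suc r))) where
  open Radix r

  ν-* : ∀ a b → a ≢ 0 → b ≢ 0 → ν p (a * b) ≡ ν p a + ν p b
  ν-* a b a≢0 b≢0 with ν-decomp a a≢0 | ν-decomp b b≢0
  ... | u , a≡ , p∤u | w , b≡ , p∤w = ν-exact (a * b) (ν p a + ν p b) (u * w) a*b≡ p∤u*w
    where
    a*b≡ : a * b ≡ p ^ (ν p a + ν p b) * (u * w)
    a*b≡ = trans (cong₂ _*_ a≡ b≡) (trans (interchange (p ^ ν p a) u (p ^ ν p b) w)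
             (cong (_* (u * w)) (sym (ℕ.^-distribˡ-+-* p (ν p a) (ν p b)))))
      where
      interchange : ∀ A u B w → (A * u) * (B * w) ≡ (A * B) * (u * w)
      interchange = ℕ.solve-∀
    p∤u*w : ¬ p ℕ.∣ u * w
    p∤u*w p∣u*w with euclidsLemma u w p-prime p∣u*w
    ... | inj₁ p∣u = p∤u p∣u
    ... | inj₂ p∣w = p∤w p∣w

  νℤ-div : ∀ z → + (p ^ νℤ p z) ∣ z
  νℤ-div z = ν-div ∣ z ∣

  νℤ-max : ∀ {e} z → z ≢ + 0 → + (p ^ e) ∣ z → e ≤ νℤ p z
  νℤ-max z z≢0 = ν-max (λ ∣z∣≡0 → z≢0 (ℤ.∣i∣≡0⇒i≡0 ∣z∣≡0))

  p^-∣-weaken : ∀ {e f} z → e ≤ f → + (p ^ f) ∣ z → + (p ^ e) ∣ z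
  p^-∣-weaken z e≤f = ℕ.∣-trans (^-monoʳ-∣ p e≤f)

  -- (p − 1)·νₚ(z) + A ≥ B, where z = 0 satisfies every bound (νₚ(0) = ∞).
  ValBound : ℤ → ℕ → ℕ → Set
  ValBound z A B = z ≡ + 0 ⊎ B ≤ q * νℤ p z + A

  ValBound-≡ : ∀ {x y A B} → x ≡ y → ValBound x A B → ValBound y A B
  ValBound-≡ refl bound = bound

  ValBound-≤ : ∀ {z A B B′} → B′ ≤ B → ValBound z A B → ValBound z A B′
  ValBound-≤ _    (inj₁ z≡0)  = inj₁ z≡0
  ValBound-≤ B′≤B (inj₂ B≤)   = inj₂ (ℕ.≤-trans B′≤B B≤)

  ValBound-weaken : ∀ {z A C} X {B} → ValBound z (A + X) C → B + X ≤ C → ValBound z A B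
  ValBound-weaken X (inj₁ z≡0) _ = inj₁ z≡0
  ValBound-weaken {z} {A} {C} X {B} (inj₂ C≤) B+X≤C =
    inj₂ (ℕ.+-cancelʳ-≤ X B (q * νℤ p z + A)
           (ℕ.≤-trans B+X≤C (subst (C ≤_) (sym (ℕ.+-assoc (q * νℤ p z) A X)) C≤)))

  ValBound-∣ : ∀ {e} z → + (p ^ e) ∣ z → ValBound z 0 (q * e)
  ValBound-∣ {e} z p^e∣z with z ℤ.≟ + 0
  ... | yes z≡0 = inj₁ z≡0
  ... | no  z≢0 =
    inj₂ (subst (q * e ≤_) (sym (ℕ.+-identityʳ (q * νℤ p z))) (ℕ.*-monoʳ-≤ q (νℤ-max z z≢0 p^e∣z)))

  ValBound-+ : ∀ {x y A B} → ValBound x A B → ValBound y A B → ValBound (x +ᶻ y) A B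
  ValBound-+ {y = y} (inj₁ refl) y-bound = ValBound-≡ (sym (ℤ.+-identityˡ y)) y-bound
  ValBound-+ {x} (inj₂ x-bound) (inj₁ refl) = ValBound-≡ (sym (ℤ.+-identityʳ x)) (inj₂ x-bound)
  ValBound-+ {x} {y} {A} {B} (inj₂ x-bound) (inj₂ y-bound) with (x +ᶻ y) ℤ.≟ + 0
  ... | yes x+y≡0 = inj₁ x+y≡0
  ... | no  x+y≢0 = inj₂ ([ (λ νx≤νy → raise x-bound (∣-+ x y (νℤ-div x) (p^-∣-weaken y νx≤νy (νℤ-div y))))
                           , (λ νy≤νx → raise y-bound (∣-+ x y (p^-∣-weaken x νy≤νx (νℤ-div x)) (νℤ-div y)))
                           ]′ (ℕ.≤-total (νℤ p x) (νℤ p y)))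
    where
    raise : ∀ {e} → B ≤ q * e + A → + (p ^ e) ∣ x +ᶻ y → B ≤ q * νℤ p (x +ᶻ y) + A
    raise B≤ p^e∣ = ℕ.≤-trans B≤ (ℕ.+-monoˡ-≤ A (ℕ.*-monoʳ-≤ q (νℤ-max (x +ᶻ y) x+y≢0 p^e∣)))

  ValBound-neg : ∀ {x A B} → ValBound x A B → ValBound (- x) A B
  ValBound-neg (inj₁ refl) = inj₁ refl
  ValBound-neg {x} {A} {B} (inj₂ bound) = inj₂ (subst (λ v → B ≤ q * ν p v + A) (sym (ℤ.∣-i∣≡∣i∣ x)) bound)

  ValBound-neg^ : ∀ k {x A B} → ValBound x A B → ValBound (neg^ k x) A B
  ValBound-neg^ zero    bound = bound
  ValBound-neg^ (suc k) bound = ValBound-neg (ValBound-neg^ k bound)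

  ValBound-* : ∀ {x y A₁ B₁ A₂ B₂} → ValBound x A₁ B₁ → ValBound y A₂ B₂ →
               ValBound (x *ᶻ y) (A₁ + A₂) (B₁ + B₂)
  ValBound-* (inj₁ refl) _ = inj₁ refl
  ValBound-* {x} (inj₂ _) (inj₁ refl) = inj₁ (ℤ.*-zeroʳ x)
  ValBound-* {x} {y} {A₁} {B₁} {A₂} {B₂} (inj₂ x-bound) (inj₂ y-bound) with (x *ᶻ y) ℤ.≟ + 0
  ... | yes x*y≡0 = inj₁ x*y≡0
  ... | no  x*y≢0 = inj₂ (begin
      B₁ + B₂
    ≤⟨ ℕ.+-mono-≤ x-bound y-bound ⟩
      (q * νℤ p x + A₁) + (q * νℤ p y + A₂)
    ≡⟨ regroup q (νℤ p x) (νℤ p y) A₁ A₂ ⟩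
      q * (νℤ p x + νℤ p y) + (A₁ + A₂)
    ≤⟨ ℕ.+-monoˡ-≤ (A₁ + A₂) (ℕ.*-monoʳ-≤ q (νℤ-max {νℤ p x + νℤ p y} (x *ᶻ y) x*y≢0 (subst (λ e → + e ∣ x *ᶻ y)
          (sym (ℕ.^-distribˡ-+-* p (νℤ p x) (νℤ p y))) (∣-* x y (νℤ-div x) (νℤ-div y))))) ⟩
      q * νℤ p (x *ᶻ y) + (A₁ + A₂)
    ∎)
    where
    open ℕ.≤-Reasoning
    regroup : ∀ q a b A₁ A₂ → (q * a + A₁) + (q * b + A₂) ≡ q * (a + b) + (A₁ + A₂)
    regroup = ℕ.solve-∀

  ValBound-cancel : ∀ i {z A B} → ValBound (+ suc i *ᶻ z) A (B + q * ν p (suc i)) → ValBound z A B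
  ValBound-cancel i {z} (inj₁ i*z≡0) with ℤ.i*j≡0⇒i≡0∨j≡0 (+ suc i) i*z≡0
  ... | inj₂ z≡0 = inj₁ z≡0
  ValBound-cancel i {z} {A} {B} (inj₂ bound) with z ℤ.≟ + 0
  ... | yes z≡0 = inj₁ z≡0
  ... | no  z≢0 =
    inj₂ (ℕ.+-cancelʳ-≤ (q * ν p (suc i)) B (q * νℤ p z + A) (ℕ.≤-trans bound (ℕ.≤-reflexive ν-split)))
    where
    ν-split : q * νℤ p (+ suc i *ᶻ z) + A ≡ (q * νℤ p z + A) + q * ν p (suc i)
    ν-split = trans (cong (λ v → q * v + A) (trans (cong (ν p) (ℤ.abs-* (+ suc i) z))
                      (ν-* (suc i) ∣ z ∣ (λ ()) (λ ∣z∣≡0 → z≢0 (ℤ.∣i∣≡0⇒i≡0 ∣z∣≡0)))))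
                    (regroup q (ν p (suc i)) (νℤ p z) A)
      where
      regroup : ∀ q a b A → q * (a + b) + A ≡ (q * b + A) + q * a
      regroup = ℕ.solve-∀

  ValBound-suc : ∀ y → ValBound (+ suc y) (σ p (suc y)) (σ p y + 1)
  ValBound-suc y = inj₂ (ℕ.≤-reflexive (trans (sym (σ-suc y)) (ℕ.+-comm (σ p (suc y)) _)))

  ValBound-∑ : ∀ n f {A B} → (∀ i → i < n → ValBound (f i) A B) → ValBound (∑ n f) A B
  ValBound-∑ zero    f bounds = inj₁ refl
  ValBound-∑ (suc n) f bounds =
    ValBound-+ (bounds 0 (s≤s z≤n)) (ValBound-∑ n (λ i → f (suc i)) (λ i i<n → bounds (suc i) (s≤s i<n)))

  ValBound-∑-except : ∀ n f c l {A B} → l < n → (∀ i → i < n → i ≢ l → ValBound (f i) A B) →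
                      ValBound (f l - c) A B → ValBound (∑ n f - c) A B
  ValBound-∑-except (suc n) f c zero    _         others at-l =
    ValBound-≡ (regroup (f 0) (∑ n (λ i → f (suc i))) c)
      (ValBound-+ at-l (ValBound-∑ n _ (λ i i<n → others (suc i) (s≤s i<n) (λ ()))))
    where
    regroup : ∀ a S c → (a - c) +ᶻ S ≡ (a +ᶻ S) - c
    regroup = solve-∀
  ValBound-∑-except (suc n) f c (suc l) (s≤s l<n) others at-l =
    ValBound-≡ (sym (ℤ.+-assoc (f 0) (∑ n (λ i → f (suc i))) (- c)))
      (ValBound-+ (others 0 (s≤s z≤n) (λ ()))
        (ValBound-∑-except n (λ i → f (suc i)) c l l<n
          (λ i i<n i≢l → others (suc i) (s≤s i<n) (λ 1+i≡1+l → i≢l (ℕ.suc-injective 1+i≡1+l))) at-l))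

  ValBound-one : ∀ {A B} → B ≤ A → ValBound (+ 1) A B
  ValBound-one {A} {B} B≤A =
    inj₂ (subst (λ v → B ≤ q * v + A) (sym (ν-coprime 1 p∤1)) (subst (B ≤_) (cong (_+ A) (sym (ℕ.*-zeroʳ q))) B≤A))
    where
    p∤1 : ¬ p ℕ.∣ 1
    p∤1 p∣1 with ℕ.∣1⇒≡1 p∣1
    ... | ()

  falling-bound : ∀ m k → k ≤ m → ValBound (+ falling m k) (σ p m) (σ p (m ∸ k) + k)
  falling-bound m zero    _     = ValBound-one (ℕ.≤-reflexive (ℕ.+-identityʳ (σ p m)))
  falling-bound m (suc k) 1+k≤m = ValBound-≡ falling-step (ValBound-weaken (σ p (suc y))
    (ValBound-* (subst (λ x → ValBound (+ falling m k) (σ p m) (σ p x + k)) m∸k≡1+y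
                       (falling-bound m k (ℕ.<⇒≤ 1+k≤m)))
                (ValBound-suc y))
    (ℕ.≤-reflexive (regroup (σ p y) k (σ p (suc y)))))
    where
    y = m ∸ suc k
    m∸k≡1+y : m ∸ k ≡ suc y
    m∸k≡1+y = ℕ.+-∸-assoc 1 1+k≤m
    falling-step : + falling m k *ᶻ + suc y ≡ + falling m (suc k)
    falling-step = trans (sym (ℤ.pos-* (falling m k) (suc y)))
                         (cong +_ (trans (cong (falling m k *_) (sym m∸k≡1+y)) (sym (falling-suc m k))))
    regroup : ∀ a k b → a + suc k + b ≡ b + k + (a + 1)
    regroup = ℕ.solve-∀

  fallingQuot-bound : ∀ m i → i < m → ValBound (+ fallingQuot m i) (σ p m) (σ p (m ∸ suc i) + 1)
  fallingQuot-bound m i i<m = ValBound-cancel i (ValBound-≤ ≤-σ+i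
    (ValBound-≡ (trans (cong +_ (sym (suc-*-fallingQuot m i))) (ℤ.pos-* (suc i) (fallingQuot m i)))
                (falling-bound m (suc i) i<m)))
    where
    ≤-σ+i : σ p (m ∸ suc i) + 1 + q * ν p (suc i) ≤ σ p (m ∸ suc i) + suc i
    ≤-σ+i = subst (_≤ σ p (m ∸ suc i) + suc i) (sym (ℕ.+-assoc (σ p (m ∸ suc i)) 1 _))
              (ℕ.+-monoʳ-≤ (σ p (m ∸ suc i)) (s≤s (q*ν[1+i]≤i i)))

  stirling1-bound : ∀ j m → ValBound (s m j) (σ p m) (σ p j)
  stirling1-bound zero    zero    = ValBound-one ℕ.≤-refl
  stirling1-bound zero    (suc m) = inj₁ refl
  stirling1-bound (suc j) m = ValBound-cancel j (ValBound-≤ (ℕ.≤-reflexive (σ-suc j))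
    (ValBound-≡ (sym (stirling1-deriv m j)) (ValBound-∑ m _ term-bound)))
    where
    term-bound : ∀ i → i < m → ValBound (neg^ i (+ fallingQuot m i) *ᶻ s (m ∸ suc i) j) (σ p m) (σ p j + 1)
    term-bound i i<m = ValBound-weaken (σ p (m ∸ suc i))
      (ValBound-* (ValBound-neg^ i (fallingQuot-bound m i i<m)) (stirling1-bound j (m ∸ suc i)))
      (ℕ.≤-reflexive (regroup (σ p j) (σ p (m ∸ suc i))))
      where
      regroup : ∀ a b → a + 1 + b ≡ b + 1 + a
      regroup = ℕ.solve-∀

  stirling1-bound-pred : ∀ n k → ValBound (s (suc n) (suc k)) (σ p n) (σ p k)
  stirling1-bound-pred n k = ValBound-≡ (sym (stirling1-expansion n k)) (ValBound-∑ (suc n) _ term-bound)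
    where
    term-bound : ∀ r → r < suc n → ValBound (neg^ r (+ falling n r) *ᶻ s (n ∸ r) k) (σ p n) (σ p k)
    term-bound r r<1+n = ValBound-weaken (σ p (n ∸ r))
      (ValBound-* (ValBound-neg^ r (falling-bound n r (ℕ.≤-pred r<1+n))) (stirling1-bound k (n ∸ r)))
      (ℕ.≤-trans (ℕ.≤-reflexive (ℕ.+-comm (σ p k) _)) (ℕ.+-monoˡ-≤ (σ p k) (ℕ.m≤m+n (σ p (n ∸ r)) r)))

  -- Shifting by a multiple of a large power of p

  xMinusPow-p-divisible : ∀ a {t} → p ^ a ℕ.∣ t → ∀ i l → + (p ^ (a * (i ∸ l))) ∣ xMinusPow t i l
  xMinusPow-p-divisible a p^a∣t i l =
    subst (λ d → d ℕ.∣ ∣ xMinusPow _ i l ∣) (ℕ.^-*-assoc p a (i ∸ l)) (xMinusPow-divisible p^a∣t i l)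

  shiftedFalling-diff-bound : ∀ a t → p ^ suc a ℕ.∣ t → ∀ N l → N < p ^ suc a → l ≤ N →
    ValBound (shiftedFalling t N l - shiftedFalling 0 N l) (σ p N) (σ p l + q)
  shiftedFalling-diff-bound a t p^1+a∣t N l N<P l≤N =
    ValBound-≡ (cong (_- shiftedFalling 0 N l) (sym (shiftedFalling-translate t N (suc N) (ℕ.n<1+n N) l)))
      (ValBound-∑-except (suc N) term (shiftedFalling 0 N l) l (s≤s l≤N) off-diagonal (inj₁ diagonal))
    where
    term : ℕ → ℤ
    term i = shiftedFalling 0 N i *ᶻ xMinusPow t i l
    diagonal : term l - shiftedFalling 0 N l ≡ + 0
    diagonal = trans (cong (λ w → shiftedFalling 0 N l *ᶻ w - shiftedFalling 0 N l) (proj₂ (xMinusPow-monic t l)))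
                     (trans (cong (_- shiftedFalling 0 N l) (ℤ.*-identityʳ (shiftedFalling 0 N l)))
                            (ℤ.+-inverseʳ (shiftedFalling 0 N l)))
    off-diagonal : ∀ i → i < suc N → i ≢ l → ValBound (term i) (σ p N) (σ p l + q)
    off-diagonal i i<1+N i≢l with ℕ.<-cmp i l
    ... | tri≈ _ i≡l _ = ⊥-elim (i≢l i≡l)
    ... | tri< i<l _ _ =
      inj₁ (trans (cong (shiftedFalling 0 N i *ᶻ_) (proj₁ (xMinusPow-monic t i) l i<l)) (ℤ.*-zeroʳ (shiftedFalling 0 N i)))
    ... | tri> _ _ l<i = ValBound-weaken 0
      (ValBound-* (ValBound-≡ (sym (shiftedFalling-zero N i)) (stirling1-bound-pred N i))
                  (ValBound-∣ _ (xMinusPow-p-divisible (suc a) p^1+a∣t i l)))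
      (subst (_≤ σ p i + q * (suc a * (i ∸ l))) (sym (ℕ.+-identityʳ (σ p l + q)))
        (σl+q≤σi+q*[1+a]*[i∸l] a l i l<i (ℕ.≤-<-trans (ℕ.≤-pred i<1+N) N<P)))

  shiftedFalling-bound : ∀ a t → p ^ suc a ℕ.∣ t → ∀ N l → N < p ^ suc a →
    ValBound (shiftedFalling t N l) (σ p N) (σ p l)
  shiftedFalling-bound a t p^1+a∣t N l N<P with l ℕ.≤? N
  ... | yes l≤N = ValBound-≡ (recombine (shiftedFalling t N l) (shiftedFalling 0 N l))
    (ValBound-+ (ValBound-≡ (sym (shiftedFalling-zero N l)) (stirling1-bound-pred N l))
                (ValBound-≤ (ℕ.m≤m+n (σ p l) q) (shiftedFalling-diff-bound a t p^1+a∣t N l N<P l≤N)))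
    where
    recombine : ∀ a b → b +ᶻ (a - b) ≡ a
    recombine = solve-∀
  ... | no  l≰N = inj₁ (proj₁ (shiftedFalling-monic t N) l (ℕ.≰⇒> l≰N))

  stirling1-shift-diff-bound : ∀ a m N M → M ≤ N → N < p ^ suc a →
    let t = suc m * p ^ suc a in
    ValBound (s (suc t + N) (suc t + M) - s (suc N) (suc M)) (σ p N) (σ p M + q)
  stirling1-shift-diff-bound a m N M M≤N N<P =
    ValBound-≡ (cong (_- s (suc N) (suc M)) (sym (stirling1-conv t N (suc t + M))))
      (ValBound-∑-except (suc (suc t + M)) term (s (suc N) (suc M)) (suc t) (s≤s (ℕ.m≤m+n (suc t) M))
        off-diagonal (ValBound-≡ diagonal (shiftedFalling-diff-bound a t p^1+a∣t N M N<P M≤N)))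
    where
    t = suc m * p ^ suc a
    p^1+a∣t : p ^ suc a ℕ.∣ t
    p^1+a∣t = divides (suc m) refl
    term : ℕ → ℤ
    term i = s (suc t) i *ᶻ shiftedFalling t N (suc t + M ∸ i)
    diagonal : shiftedFalling t N M - shiftedFalling 0 N M ≡ term (suc t) - s (suc N) (suc M)
    diagonal = cong₂ _-_
      (sym (trans (cong₂ (λ a i → a *ᶻ shiftedFalling t N i) (proj₂ (stirling1-monic (suc t))) (ℕ.m+n∸m≡n (suc t) M))
                  (ℤ.*-identityˡ (shiftedFalling t N M))))
      (shiftedFalling-zero N M)
    off-diagonal : ∀ i → i < suc (suc t + M) → i ≢ suc t → ValBound (term i) (σ p N) (σ p M + q)
    off-diagonal zero    _ _ = inj₁ refl
    off-diagonal (suc c) _ 1+c≢1+t with ℕ.<-cmp c t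
    ... | tri≈ _ c≡t _ = ⊥-elim (1+c≢1+t (cong suc c≡t))
    ... | tri> _ _ t<c =
      inj₁ (cong (_*ᶻ shiftedFalling t N (t + M ∸ c)) (proj₁ (stirling1-monic (suc t)) (suc c) (s≤s t<c)))
    ... | tri< c<t _ _ with (t + M ∸ c) ℕ.≤? N
    ...   | no  j≰N = inj₁ (trans (cong (s (suc t) (suc c) *ᶻ_) (proj₁ (shiftedFalling-monic t N) _ (ℕ.≰⇒> j≰N)))
                                  (ℤ.*-zeroʳ (s (suc t) (suc c))))
    ...   | yes j≤N = ValBound-≡ (ℤ.*-comm (shiftedFalling t N j) (s (suc t) (suc c))) (ValBound-weaken (σ p t)
        (ValBound-* (shiftedFalling-bound a t p^1+a∣t N j N<P) (stirling1-bound-pred t c))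
        (σ-offDiagonal (suc a) m c<t (ℕ.m+[n∸m]≡n (ℕ.≤-trans (ℕ.<⇒≤ c<t) (ℕ.m≤m+n t M)))
                                     (ℕ.≤-<-trans j≤N N<P)))
      where
      j = t + M ∸ c

  ValBound⇒p^∣ : ∀ {z d A B} → q * νℤ p z + A ≡ B → ValBound d A (B + q) → + (p ^ suc (νℤ p z)) ∣ d
  ValBound⇒p^∣ {z} {d} _ (inj₁ refl) = ℕ._∣0 (p ^ suc (νℤ p z))
  ValBound⇒p^∣ {z} {d} {A} refl (inj₂ bound) = p^-∣-weaken d (ℕ.*-cancelˡ-≤ q (ℕ.+-cancelʳ-≤ A _ _
    (subst (_≤ q * νℤ p d + A) (regroup q (νℤ p z) A) bound))) (νℤ-div d)
    where
    regroup : ∀ q v A → q * v + A + q ≡ q * suc v + A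
    regroup = ℕ.solve-∀

  ε-*-p^ν : ∀ z → z ≡ ε p z *ᶻ + (p ^ νℤ p z)
  ε-*-p^ν z = begin
      z
    ≡⟨ ℤ.◃-inverse z ⟨
      sign z ◃ ∣ z ∣
    ≡⟨ cong (sign z ◃_) (sym (divP-* (νℤ p z) (νℤ-div z))) ⟩
      sign z ◃ (u * p ^ νℤ p z)
    ≡⟨ cong (_◃ (u * p ^ νℤ p z)) (Sign.*-identityʳ (sign z)) ⟨
      (sign z Sign.* Sign.+) ◃ (u * p ^ νℤ p z)
    ≡⟨ ℤ.◃-distrib-* (sign z) Sign.+ u (p ^ νℤ p z) ⟩
      (sign z ◃ u) *ᶻ (Sign.+ ◃ p ^ νℤ p z)
    ≡⟨ cong ((sign z ◃ u) *ᶻ_) (ℤ.+◃n≡+n (p ^ νℤ p z)) ⟩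
      ε p z *ᶻ + (p ^ νℤ p z)
    ∎
    where
    open ≡-Reasoning
    u = divP (p ^ νℤ p z) ∣ z ∣
    divP-* : ∀ e {x} → p ^ e ℕ.∣ x → divP (p ^ e) x * p ^ e ≡ x
    divP-* e d with p ^ e | p^≢0 e
    ... | zero  | p^e≢0 = ⊥-elim (p^e≢0 refl)
    ... | suc _ | _     = ℕ.m/n*n≡m d

  νℤ-stable : ∀ s₀ s₁ → s₀ ≢ + 0 → + (p ^ suc (νℤ p s₀)) ∣ (s₁ - s₀) → νℤ p s₁ ≡ νℤ p s₀
  νℤ-stable s₀ s₁ s₀≢0 p^1+v∣D = ℕ.≤-antisym upper (νℤ-max s₁ s₁≢0 p^v∣s₁)
    where
    v = νℤ p s₀
    ¬p^1+v∣s₁ : ¬ + (p ^ suc v) ∣ s₁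
    ¬p^1+v∣s₁ p^1+v∣s₁ = ℕ.<-irrefl refl (νℤ-max s₀ s₀≢0 (subst (+ (p ^ suc v) ∣_) (cancel s₁ s₀)
      (∣-+ s₁ (- (s₁ - s₀)) p^1+v∣s₁ (∣-neg (s₁ - s₀) p^1+v∣D))))
      where
      cancel : ∀ a b → a +ᶻ - (a - b) ≡ b
      cancel = solve-∀
    s₁≢0 : s₁ ≢ + 0
    s₁≢0 s₁≡0 = ¬p^1+v∣s₁ (subst (+ (p ^ suc v) ∣_) (sym s₁≡0) (ℕ._∣0 (p ^ suc v)))
    p^v∣s₁ : + (p ^ v) ∣ s₁
    p^v∣s₁ = subst (+ (p ^ v) ∣_) (recombine s₁ s₀)
               (∣-+ s₀ (s₁ - s₀) (νℤ-div s₀) (p^-∣-weaken (s₁ - s₀) (ℕ.n≤1+n v) p^1+v∣D))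
      where
      recombine : ∀ a b → b +ᶻ (a - b) ≡ a
      recombine = solve-∀
    upper : νℤ p s₁ ≤ v
    upper with νℤ p s₁ ℕ.≤? v
    ... | yes ν₁≤v = ν₁≤v
    ... | no  ν₁≰v = ⊥-elim (¬p^1+v∣s₁ (p^-∣-weaken s₁ (ℕ.≰⇒> ν₁≰v) (νℤ-div s₁)))

  ε-congruent : ∀ s₀ s₁ → s₀ ≢ + 0 → + (p ^ suc (νℤ p s₀)) ∣ (s₁ - s₀) → + p ∣ (ε p s₁ - ε p s₀)
  ε-congruent s₀ s₁ s₀≢0 p^1+v∣D = ℕ.*-cancelˡ-∣ (p ^ v) {{ℕ.m^n≢0 p v}}
    (subst₂ ℕ._∣_ (ℕ.*-comm p (p ^ v))
      (trans (cong ∣_∣ D≡) (trans (ℤ.abs-* (ε p s₁ - ε p s₀) (+ (p ^ v))) (ℕ.*-comm _ (p ^ v)))) p^1+v∣D)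
    where
    v = νℤ p s₀
    D≡ : s₁ - s₀ ≡ (ε p s₁ - ε p s₀) *ᶻ + (p ^ v)
    D≡ = trans (cong₂ _-_ (trans (ε-*-p^ν s₁) (cong (λ x → ε p s₁ *ᶻ + (p ^ x)) (νℤ-stable s₀ s₁ s₀≢0 p^1+v∣D)))
                          (ε-*-p^ν s₀))
               (factor (ε p s₁) (ε p s₀) (+ (p ^ v)))
      where
      factor : ∀ a b c → a *ᶻ c - b *ᶻ c ≡ (a - b) *ᶻ c
      factor = solve-∀

  σ-shift : ∀ a m X → X < p ^ a → σ p (suc m * p ^ a + suc X ∸ 1) ≡ σ p X + σ p (suc m)
  σ-shift a m X X<P = trans (cong (λ y → σ p (y ∸ 1)) (ℕ.+-suc (suc m * p ^ a) X))
                            (trans (cong (σ p) (ℕ.+-comm (suc m * p ^ a) X)) (σ-+-*p^ a X (suc m) X<P))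

  minZeroCase-shift-multiple : ∀ a m N M → M ≤ N → N < p ^ suc a → MinZeroCase p (suc N) (suc M) →
                               ShiftedMinZeroCase p (suc N) (suc M) (suc m * p ^ suc a)
  minZeroCase-shift-multiple a m N M M≤N N<P minZero = minZero′ , ν-equal , ε-congruent s₀ s₁ s₀≢0 p^1+ν∣s₁-s₀
    where
    open ≡-Reasoning
    t = suc m * p ^ suc a
    s₀ = s (suc N) (suc M)
    s₁ = s (t + suc N) (t + suc M)
    p^1+ν∣s₁-s₀ : + (p ^ suc (νℤ p s₀)) ∣ (s₁ - s₀)
    p^1+ν∣s₁-s₀ = ValBound⇒p^∣ {s₀} minZero
      (ValBound-≡ (cong₂ (λ n k → s n k - s₀) (sym (ℕ.+-suc t N)) (sym (ℕ.+-suc t M)))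
                  (stirling1-shift-diff-bound a m N M M≤N N<P))
    s₀≢0 : s₀ ≢ + 0
    s₀≢0 = stirling1-nonzero N M M≤N
    ν-equal : νℤ p s₁ ≡ νℤ p s₀
    ν-equal = νℤ-stable s₀ s₁ s₀≢0 p^1+ν∣s₁-s₀
    minZero′ : q * νℤ p s₁ + σ p (t + suc N ∸ 1) ≡ σ p (t + suc M ∸ 1)
    minZero′ = begin
        q * νℤ p s₁ + σ p (t + suc N ∸ 1)
      ≡⟨ cong₂ (λ v x → q * v + x) ν-equal (σ-shift (suc a) m N N<P) ⟩
        q * νℤ p s₀ + (σ p N + σ p (suc m))
      ≡⟨ ℕ.+-assoc (q * νℤ p s₀) (σ p N) (σ p (suc m)) ⟨
        q * νℤ p s₀ + σ p N + σ p (suc m)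
      ≡⟨ cong (_+ σ p (suc m)) minZero ⟩
        σ p M + σ p (suc m)
      ≡⟨ σ-shift (suc a) m M (ℕ.≤-<-trans M≤N N<P) ⟨
        σ p (t + suc M ∸ 1)
      ∎

  -- t = 0 is excluded by the junk value ν p 0 = 0.
  p^ν-multiple : ∀ t a → ν p t ≡ suc a → Σ[ m ∈ ℕ ] t ≡ suc m * p ^ suc a
  p^ν-multiple t a νt≡1+a with ν-div t
  ... | divides zero    t≡0 with subst (λ x → ν p x ≡ suc a) t≡0 νt≡1+a
  ...   | ()
  p^ν-multiple t a νt≡1+a | divides (suc m) t≡ = m , trans t≡ (cong (λ e → suc m * p ^ e) νt≡1+a)

  minZeroCase-shift-invariant : ∀ n k t → 1 ≤ k → k ≤ n → MinZeroCase p n k → (t ≡ 0 ⊎ n < p ^ ν p t) →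
                                ShiftedMinZeroCase p n k t
  minZeroCase-shift-invariant n k .0 _ _ minZero (inj₁ refl) =
    minZero , refl , subst (λ z → p ℕ.∣ ∣ z ∣) (sym (ℤ.+-inverseʳ (ε p (s n k)))) (ℕ._∣0 p)
  minZeroCase-shift-invariant (suc N) (suc M) t (s≤s z≤n) (s≤s M≤N) minZero (inj₂ n<p^νt) with ν p t in νt≡
  ... | zero  = ⊥-elim (ℕ.n≮0 (ℕ.≤-pred n<p^νt))
  ... | suc a with p^ν-multiple t a νt≡
  ...   | m , refl = minZeroCase-shift-multiple a m N M M≤N (ℕ.<-trans (ℕ.n<1+n N) n<p^νt) minZero

theorem3p3 : (p n k t : ℕ) → Prime p → 1 ≤ k → k ≤ n → MinZeroCase p n k
    → (t ≡ 0 ⊎ n < p ^ ν p t)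
    → MinZeroCase p (t + n) (t + k)
      × νℤ p (stirling1 (t + n) (t + k)) ≡ νℤ p (stirling1 n k)
      × (+ p) ∣ (ε p (stirling1 (t + n) (t + k)) - ε p (stirling1 n k))
theorem3p3 zero          _ _ _ ()
theorem3p3 (suc zero)    _ _ _ ()
theorem3p3 (suc (suc r)) n k t p-prime = PrimeRadix.minZeroCase-shift-invariant r p-prime n k t
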